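{- Let $n\ge 2k$, and let $P=[p_{ij}]$ range over $k\times k$ permutation matrices. Then \[\max_P \mathrm{m}(n,P)=\begin{cases} n^2 & k=1,\\ n^2-2 & k=2,\\ n^2-5 & k=3,\\ n^2-4k+8 & k\ge 4.\end{cases}\] Moreover, for $k\ge 4$ this maximum is attained by $P$ if and only if either $p_{1,2},p_{2,k},p_{k,k-1},p_{k-1,1}$ are all $1$-entries, or $p_{2,1},p_{k,2},p_{k-1,k},p_{1,k-1}$ are all $1$-entries.
   Context: All matrices are $(0,1)$-matrices. An $n\times n$ matrix $A$ is $P$-forcing if every $k\times k$ submatrix of $A$ (any $k$ rows and any $k$ columns, order kept) is entrywise $\ge P$; $\mathrm{m}(n,P)$ is the minimum number of $1$-entries of an $n\times n$ $P$-forcing matrix. -}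

module Defs where

open import Data.Nat using (ℕ; zero; suc; _+_; _*_; _∸_; _≤_)
open import Data.Bool using (Bool; true; false; if_then_else_)
open import Data.Fin using (Fin; toℕ) renaming (_<_ to _<ᶠ_)
open import Data.List using (List; map; allFin)
open import Data.Nat.ListAction using (sum)
open import Data.Product using (Σ; _×_; ∃)
open import Relation.Binary.PropositionalEquality using (_≡_)

-- A (0,1)-matrix with r rows and c columns (true = 1-entry).
Matrix : ℕ → ℕ → Set
Matrix r c = Fin r → Fin c → Bool

ones : ∀ {r c} → Matrix r c → ℕ
ones {r} {c} A = sum (map (λ i → sum (map (λ j → if A i j then 1 else 0) (allFin c))) (allFin r))

ExactlyOneInRow : ∀ {k} → Matrix k k → Fin k → Set
ExactlyOneInRow P i = Σ _ λ j → P i j ≡ true × (∀ j' → P i j' ≡ true → j' ≡ j)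

ExactlyOneInCol : ∀ {k} → Matrix k k → Fin k → Set
ExactlyOneInCol P j = Σ _ λ i → P i j ≡ true × (∀ i' → P i' j ≡ true → i' ≡ i)

IsPermutationMatrix : ∀ {k} → Matrix k k → Set
IsPermutationMatrix P = (∀ i → ExactlyOneInRow P i) × (∀ j → ExactlyOneInCol P j)

Increasing : ∀ {k n} → (Fin k → Fin n) → Set
Increasing f = ∀ i j → i <ᶠ j → f i <ᶠ f j

Forcing : ∀ {n k} → Matrix n n → Matrix k k → Set
Forcing A P = ∀ r c → Increasing r → Increasing c →
  ∀ i j → P i j ≡ true → A (r i) (c j) ≡ true

-- v = m(n,P): v is the minimum number of 1-entries of an n×n P-forcing matrix.
IsMinForcing : ∀ n {k} → Matrix k k → ℕ → Set
IsMinForcing n P v =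
  (Σ (Matrix n n) λ A → Forcing A P × ones A ≡ v) ×
  (∀ (A : Matrix n n) → Forcing A P → v ≤ ones A)

-- Entry p_{i+1, j+1} (0-based natural-number indices i, j) of P is a 1-entry.
EntryOne : ∀ {k} → Matrix k k → ℕ → ℕ → Set
EntryOne P i j = Σ _ λ a → Σ _ λ b → toℕ a ≡ i × toℕ b ≡ j × P a b ≡ true

maxValue : ℕ → ℕ → ℕ
maxValue n 0 = n * n
maxValue n 1 = n * n
maxValue n 2 = n * n ∸ 2
maxValue n 3 = n * n ∸ 5
maxValue n (suc (suc (suc (suc k)))) = (n * n + 8) ∸ 4 * (4 + k)

-- Write P as a permutation q of {0, …, k-1} and n = k + d with d ≥ k. An order-preserving selection
-- can send the 1-entry (i, q i) of P to exactly the positions (a, b) with i ≤ a ≤ i + d and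
-- q i ≤ b ≤ q i + d, so the union of these k boxes is the unique minimal P-forcing matrix.
-- Since d ≥ k, each of its 0-entries lies in exactly one of four corner staircases: the north-west
-- one {(a, b) : b < q i for every i ≤ a} and its three reflections. A staircase built from a
-- permutation h with h r = 0 has between h 0 + r - 1 and r · h 0 cells, with h 0 + r cells at least
-- when h 0 = 0 or h 0, h 1 ≥ 2. Over the four corners the values h 0 + r add up to 4(k - 1), so
-- there are at least 4k - 8 zeros. For k ≥ 4 equality forces every corner to its smallest size,
-- which pins down the four entries of the statement; for k ≤ 3 distinctness of q gives the
-- sharper counts.
module Submission where

open import Data.Bool using (Bool; true; false; if_then_else_; _∧_; _∨_)
open import Data.Bool.Properties using (¬-not; not-¬; T-≡)
open import Data.Empty using (⊥; ⊥-elim)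
open import Data.Fin using (Fin; toℕ; fromℕ<; inject₁) renaming (zero to fzero; suc to fsuc)
open import Data.Fin.Properties using (toℕ-injective; toℕ<n; toℕ-fromℕ<; fromℕ<-toℕ; toℕ-inject₁)
open import Data.List using (List; []; _∷_; map; allFin; tabulate)
open import Data.List.Properties using (map-tabulate)
open import Data.Nat
open import Data.Nat.ListAction using (sum)
open import Data.Nat.Properties
open import Algebra.Properties.CommutativeSemigroup +-commutativeSemigroup
  using () renaming (interchange to +-interchange)
open import Data.Nat.Tactic.RingSolver using (solve-∀)
open import Data.Product using (Σ; _×_; _,_; proj₁; proj₂)
open import Data.Sum using (_⊎_; inj₁; inj₂; [_,_]′)
open import Function using (_∘_; id)
open import Function.Bundles using (_⇔_; mk⇔; Equivalence)
open import Relation.Binary.PropositionalEquality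
open import Relation.Nullary using (¬_; yes; no; contradiction)

open import Defs

⟦_⟧ : Bool → ℕ
⟦ b ⟧ = if b then 1 else 0

∑ : ℕ → (ℕ → ℕ) → ℕ
∑ zero    f = 0
∑ (suc n) f = f 0 + ∑ n (f ∘ suc)

∑-cong : ∀ n {f g : ℕ → ℕ} → (∀ i → i < n → f i ≡ g i) → ∑ n f ≡ ∑ n g
∑-cong zero    h = refl
∑-cong (suc n) h = cong₂ _+_ (h 0 z<s) (∑-cong n (λ i i<n → h (suc i) (s<s i<n)))

∑-mono-≤ : ∀ n {f g : ℕ → ℕ} → (∀ i → i < n → f i ≤ g i) → ∑ n f ≤ ∑ n g
∑-mono-≤ zero    h = z≤n
∑-mono-≤ (suc n) h = +-mono-≤ (h 0 z<s) (∑-mono-≤ n (λ i i<n → h (suc i) (s<s i<n)))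

∑-distrib-+ : ∀ n (f g : ℕ → ℕ) → ∑ n (λ i → f i + g i) ≡ ∑ n f + ∑ n g
∑-distrib-+ zero    f g = refl
∑-distrib-+ (suc n) f g = begin
  (f 0 + g 0) + ∑ n (λ i → f (suc i) + g (suc i)) ≡⟨ cong ((f 0 + g 0) +_) (∑-distrib-+ n (f ∘ suc) (g ∘ suc)) ⟩
  (f 0 + g 0) + (∑ n (f ∘ suc) + ∑ n (g ∘ suc))   ≡⟨ +-interchange (f 0) (g 0) _ _ ⟩
  (f 0 + ∑ n (f ∘ suc)) + (g 0 + ∑ n (g ∘ suc))   ∎
  where open ≡-Reasoning

∑-suc : ∀ n (f : ℕ → ℕ) → ∑ (suc n) f ≡ ∑ n f + f n
∑-suc zero    f = +-comm (f 0) 0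
∑-suc (suc n) f = trans (cong (f 0 +_) (∑-suc n (f ∘ suc))) (sym (+-assoc (f 0) _ _))

∑-reverse : ∀ n (f : ℕ → ℕ) → ∑ n (λ i → f (n ∸ suc i)) ≡ ∑ n f
∑-reverse zero    f = refl
∑-reverse (suc n) f = trans (cong (f n +_) (∑-reverse n f)) (trans (+-comm (f n) _) (sym (∑-suc n f)))

∑-++ : ∀ m n (f : ℕ → ℕ) → ∑ (m + n) f ≡ ∑ m f + ∑ n (λ i → f (m + i))
∑-++ zero    n f = refl
∑-++ (suc m) n f = trans (cong (f 0 +_) (∑-++ m n (f ∘ suc))) (sym (+-assoc (f 0) _ _))

∑-const : ∀ n c → ∑ n (λ _ → c) ≡ n * c
∑-const zero    c = refl
∑-const (suc n) c = cong (c +_) (∑-const n c)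

∑-zero : ∀ n (f : ℕ → ℕ) → (∀ i → i < n → f i ≡ 0) → ∑ n f ≡ 0
∑-zero n f h = trans (∑-cong n h) (trans (∑-const n 0) (*-zeroʳ n))

∑-≤-* : ∀ n (f : ℕ → ℕ) c → (∀ i → i < n → f i ≤ c) → ∑ n f ≤ n * c
∑-≤-* n f c h = ≤-trans (∑-mono-≤ n h) (≤-reflexive (∑-const n c))

∑-prefix-≤ : ∀ r n (g f : ℕ → ℕ) → r ≤ n → (∀ i → i < r → g i ≤ f i) → ∑ r g ≤ ∑ n f
∑-prefix-≤ zero    n       g f _         _ = z≤n
∑-prefix-≤ (suc r) (suc n) g f (s≤s r≤n) h =
  +-mono-≤ (h 0 z<s) (∑-prefix-≤ r n (g ∘ suc) (f ∘ suc) r≤n (λ i i<r → h (suc i) (s<s i<r)))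

∑-ones : ∀ n → ∑ n (λ _ → 1) ≡ n
∑-ones n = trans (∑-const n 1) (*-identityʳ n)

∑-head+positive : ∀ N m (f : ℕ → ℕ) → m ≤ N → (∀ i → i < m → 1 ≤ f (suc i)) → f 0 + m ≤ ∑ (suc N) f
∑-head+positive N m f m≤N h =
  +-monoʳ-≤ (f 0) (subst (_≤ _) (∑-ones m) (∑-prefix-≤ m N (λ _ → 1) (f ∘ suc) m≤N h))

∑-head+steep : ∀ N m (f : ℕ → ℕ) → 1 ≤ m → m ≤ N → 2 ≤ f 1 → (∀ i → i < m → 1 ≤ f (suc i)) →
  f 0 + suc m ≤ ∑ (suc N) f
∑-head+steep (suc N) (suc m) f _ (s≤s m≤N) f₁≥2 h = +-monoʳ-≤ (f 0) (+-mono-≤ f₁≥2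
  (subst (_≤ _) (∑-ones m) (∑-prefix-≤ m N (λ _ → 1) (f ∘ suc ∘ suc) m≤N (λ i i<m → h (suc i) (s<s i<m)))))

∑-count-< : ∀ n x → x ≤ n → ∑ n (λ b → ⟦ b <ᵇ x ⟧) ≡ x
∑-count-< n       zero    _         = ∑-zero n _ (λ { zero _ → refl ; (suc i) _ → refl })
∑-count-< (suc n) (suc x) (s≤s x≤n) = cong suc (∑-count-< n x x≤n)

∑-tabulate : ∀ m (g : Fin m → ℕ) (f : ℕ → ℕ) → (∀ i → g i ≡ f (toℕ i)) → sum (tabulate g) ≡ ∑ m f
∑-tabulate zero    g f h = refl
∑-tabulate (suc m) g f h = cong₂ _+_ (h fzero) (∑-tabulate m (g ∘ fsuc) (f ∘ suc) (h ∘ fsuc))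

sum-allFin≡∑ : ∀ m (g : Fin m → ℕ) (f : ℕ → ℕ) → (∀ i → g i ≡ f (toℕ i)) → sum (map g (allFin m)) ≡ ∑ m f
sum-allFin≡∑ m g f h = trans (cong sum (map-tabulate id g)) (∑-tabulate m g f h)

sum-map-mono-≤ : ∀ {A : Set} (xs : List A) (f g : A → ℕ) → (∀ x → f x ≤ g x) → sum (map f xs) ≤ sum (map g xs)
sum-map-mono-≤ []       f g h = z≤n
sum-map-mono-≤ (x ∷ xs) f g h = +-mono-≤ (h x) (sum-map-mono-≤ xs f g h)

≤⇒≤ᵇ≡true : ∀ {m n} → m ≤ n → (m ≤ᵇ n) ≡ true
≤⇒≤ᵇ≡true = Equivalence.to T-≡ ∘ ≤⇒≤ᵇ

≤ᵇ≡true⇒≤ : ∀ {m n} → (m ≤ᵇ n) ≡ true → m ≤ n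
≤ᵇ≡true⇒≤ {m} {n} = ≤ᵇ⇒≤ m n ∘ Equivalence.from T-≡

<⇒<ᵇ≡true : ∀ {m n} → m < n → (m <ᵇ n) ≡ true
<⇒<ᵇ≡true = Equivalence.to T-≡ ∘ <⇒<ᵇ

<ᵇ≡true⇒< : ∀ {m n} → (m <ᵇ n) ≡ true → m < n
<ᵇ≡true⇒< {m} {n} = <ᵇ⇒< m n ∘ Equivalence.from T-≡

<ᵇ≡false⇒≥ : ∀ {m n} → (m <ᵇ n) ≡ false → n ≤ m
<ᵇ≡false⇒≥ p = ≮⇒≥ (not-¬ p ∘ <⇒<ᵇ≡true)

∧-intro : ∀ {a b} → a ≡ true → b ≡ true → (a ∧ b) ≡ true
∧-intro refl refl = refl

∧-projₗ : ∀ a {b} → (a ∧ b) ≡ true → a ≡ true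
∧-projₗ true _ = refl

∧-projᵣ : ∀ a {b} → (a ∧ b) ≡ true → b ≡ true
∧-projᵣ true p = p

∨-injₗ : ∀ {a} b → a ≡ true → (a ∨ b) ≡ true
∨-injₗ b refl = refl

∨-injᵣ : ∀ a {b} → b ≡ true → (a ∨ b) ≡ true
∨-injᵣ true  _ = refl
∨-injᵣ false p = p

∨-elim : ∀ a {b} → (a ∨ b) ≡ true → a ≡ true ⊎ b ≡ true
∨-elim true  _ = inj₁ refl
∨-elim false p = inj₂ p

∨≡false : ∀ a {b} → (a ∨ b) ≡ false → a ≡ false × b ≡ false
∨≡false false p = refl , p

Bool-ext : ∀ {a b : Bool} → (a ≡ true → b ≡ true) → (b ≡ true → a ≡ true) → a ≡ b
Bool-ext {true}  f g = sym (f refl)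
Bool-ext {false} {true}  f g = g refl
Bool-ext {false} {false} f g = refl

all< : ℕ → (ℕ → Bool) → Bool
all< zero    g = true
all< (suc k) g = g k ∧ all< k g

any< : ℕ → (ℕ → Bool) → Bool
any< zero    g = false
any< (suc k) g = g k ∨ any< k g

all<-intro : ∀ k (g : ℕ → Bool) → (∀ i → i < k → g i ≡ true) → all< k g ≡ true
all<-intro zero    g h = refl
all<-intro (suc k) g h = ∧-intro (h k ≤-refl) (all<-intro k g (λ i i<k → h i (m≤n⇒m≤1+n i<k)))

all<-elim : ∀ k (g : ℕ → Bool) → all< k g ≡ true → ∀ i → i < k → g i ≡ true
all<-elim (suc k) g p i i<1+k with m≤n⇒m<n∨m≡n (s≤s⁻¹ i<1+k)
... | inj₁ i<k  = all<-elim k g (∧-projᵣ (g k) p) i i<k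
... | inj₂ refl = ∧-projₗ (g i) p

all<≡false : ∀ k (g : ℕ → Bool) → all< k g ≡ false → Σ ℕ λ i → i < k × g i ≡ false
all<≡false (suc k) g p with g k in eq
... | false = k , ≤-refl , eq
... | true with all<≡false k g p
...   | i , i<k , gi = i , m≤n⇒m≤1+n i<k , gi

any<-intro : ∀ k (g : ℕ → Bool) i → i < k → g i ≡ true → any< k g ≡ true
any<-intro (suc k) g i i<1+k p with m≤n⇒m<n∨m≡n (s≤s⁻¹ i<1+k)
... | inj₁ i<k  = ∨-injᵣ (g k) (any<-intro k g i i<k p)
... | inj₂ refl = ∨-injₗ (any< i g) p

any<-elim : ∀ k (g : ℕ → Bool) → any< k g ≡ true → Σ ℕ λ i → i < k × g i ≡ true
any<-elim (suc k) g p with ∨-elim (g k) p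
... | inj₁ gk = k , ≤-refl , gk
... | inj₂ q with any<-elim k g q
...   | i , i<k , gi = i , m≤n⇒m≤1+n i<k , gi

<∸⇒+< : ∀ {x y M} → x < M ∸ y → x + y < M
<∸⇒+< {x} {y} {M} p with y ≤? M
... | yes y≤M = m≤o∸n⇒m+n≤o (suc x) y≤M p
... | no  y≰M with () ← subst (x <_) (m≤n⇒m∸n≡0 (<⇒≤ (≰⇒> y≰M))) p

module _ (K d : ℕ) where

  private
    K+d≡K∸j+[j+d] : ∀ {j} → j ≤ K → K + d ≡ (K ∸ j) + (j + d)
    K+d≡K∸j+[j+d] {j} j≤K = trans (cong (_+ d) (sym (m∸n+n≡m j≤K))) (+-assoc (K ∸ j) j d)

  reflect-< : ∀ {b x} → b ≤ K + d → ((K + d) ∸ b < K ∸ x ⇔ x + d < b)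
  reflect-< {b} {x} b≤ = mk⇔
    (λ p → +-cancelˡ-< ((K + d) ∸ b) _ _ (subst (_< (K + d) ∸ b + b) (+-assoc ((K + d) ∸ b) x d)
      (subst (((K + d) ∸ b + x) + d <_) (sym (m∸n+n≡m b≤)) (+-monoˡ-< d (<∸⇒+< p)))))
    (λ p → m+n≤o⇒m≤o∸n (suc _) (+-cancelʳ-< d _ _ (subst (_< K + d) (sym (+-assoc ((K + d) ∸ b) x d))
      (subst (((K + d) ∸ b) + (x + d) <_) (m∸n+n≡m b≤) (+-monoʳ-< ((K + d) ∸ b) p)))))

  reflect-≤ : ∀ {a j} → a ≤ K + d → j ≤ K → (K ∸ j ≤ (K + d) ∸ a ⇔ a ≤ j + d)
  reflect-≤ {a} {j} a≤ j≤K = mk⇔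
    (λ p → +-cancelˡ-≤ (K ∸ j) _ _ (subst ((K ∸ j) + a ≤_) (K+d≡K∸j+[j+d] j≤K) (m≤o∸n⇒m+n≤o (K ∸ j) a≤ p)))
    (λ p → m+n≤o⇒m≤o∸n (K ∸ j) (subst ((K ∸ j) + a ≤_) (sym (K+d≡K∸j+[j+d] j≤K)) (+-monoʳ-≤ (K ∸ j) p)))

record IsPermutation< (k : ℕ) (h : ℕ → ℕ) : Set where
  field
    bounded    : ∀ i → i < k → h i < k
    surjective : ∀ j → j < k → Σ ℕ λ i → i < k × h i ≡ j
    injective  : ∀ i j → i < k → j < k → h i ≡ h j → i ≡ j

module _ {K : ℕ} {h : ℕ → ℕ} (perm : IsPermutation< (suc K) h) where
  open IsPermutation< perm

  private
    K∸i<1+K : ∀ i → K ∸ i < suc K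
    K∸i<1+K i = s≤s (m∸n≤m K i)

    K∸-involutive : ∀ {i} → i < suc K → K ∸ (K ∸ i) ≡ i
    K∸-involutive i<k = m∸[m∸n]≡n (s≤s⁻¹ i<k)

    K∸-injective : ∀ {i j} → i < suc K → j < suc K → K ∸ i ≡ K ∸ j → i ≡ j
    K∸-injective i<k j<k e = trans (sym (K∸-involutive i<k)) (trans (cong (K ∸_) e) (K∸-involutive j<k))

  complement-permutation : IsPermutation< (suc K) (λ i → K ∸ h i)
  complement-permutation = record
    { bounded    = λ i _ → K∸i<1+K (h i)
    ; surjective = λ j j<k → let (i , i<k , hi) = surjective (K ∸ j) (K∸i<1+K j)
                             in i , i<k , trans (cong (K ∸_) hi) (K∸-involutive j<k)
    ; injective  = λ i j i<k j<k e → injective i j i<k j<k (K∸-injective (bounded i i<k) (bounded j j<k) e)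
    }

  reverse-permutation : IsPermutation< (suc K) (λ i → h (K ∸ i))
  reverse-permutation = record
    { bounded    = λ i _ → bounded (K ∸ i) (K∸i<1+K i)
    ; surjective = λ j j<k → let (i , i<k , hi) = surjective j j<k
                             in K ∸ i , K∸i<1+K i , trans (cong h (K∸-involutive i<k)) hi
    ; injective  = λ i j i<k j<k e → K∸-injective i<k j<k (injective _ _ (K∸i<1+K i) (K∸i<1+K j) e)
    }

-- Staircases

-- What the counting needs about a staircase with z cells built from a permutation h with
-- h 0 = h₀, h 1 = h₁ and h r = 0.
record StaircaseBounds (h₀ h₁ r z : ℕ) : Set where
  field
    lower          : h₀ + r ≤ z + 1
    lower-if-h₀≡0  : h₀ ≡ 0 → h₀ + r + 1 ≤ z + 1
    lower-if-steep : 2 ≤ h₀ → 2 ≤ h₁ → h₀ + r + 1 ≤ z + 1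
    upper          : z ≤ r * h₀

module Staircase (k N : ℕ) (k≤n : k ≤ suc N) where

  n : ℕ
  n = suc N

  staircase : (ℕ → ℕ) → ℕ → ℕ → Bool
  staircase h a b = all< k (λ i → (a <ᵇ i) ∨ (b <ᵇ h i))

  staircase-intro : ∀ h a b → (∀ i → i < k → i ≤ a → b < h i) → staircase h a b ≡ true
  staircase-intro h a b H = all<-intro k _ below
    where
    below : ∀ i → i < k → ((a <ᵇ i) ∨ (b <ᵇ h i)) ≡ true
    below i i<k with a <? i
    ... | yes a<i = ∨-injₗ _ (<⇒<ᵇ≡true a<i)
    ... | no  a≮i = ∨-injᵣ (a <ᵇ i) (<⇒<ᵇ≡true (H i i<k (≮⇒≥ a≮i)))

  staircase-elim : ∀ h a b → staircase h a b ≡ true → ∀ i → i < k → i ≤ a → b < h i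
  staircase-elim h a b p i i<k i≤a with ∨-elim (a <ᵇ i) (all<-elim k _ p i i<k)
  ... | inj₁ a<i = ⊥-elim (<⇒≱ (<ᵇ≡true⇒< a<i) i≤a)
  ... | inj₂ b<hi = <ᵇ≡true⇒< b<hi

  staircase≡false : ∀ h a b → staircase h a b ≡ false → Σ ℕ λ i → i < k × i ≤ a × h i ≤ b
  staircase≡false h a b p with all<≡false k _ p
  ... | i , i<k , e with ∨≡false (a <ᵇ i) e
  ...   | a≮i , b≮hi = i , i<k , <ᵇ≡false⇒≥ a≮i , <ᵇ≡false⇒≥ b≮hi

  rowSize : (ℕ → ℕ) → ℕ → ℕ
  rowSize h a = ∑ n (λ b → ⟦ staircase h a b ⟧)

  size : (ℕ → ℕ) → ℕ
  size h = ∑ n (rowSize h)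

  module _ (h : ℕ → ℕ) (perm : IsPermutation< k h) (r : ℕ) (r<k : r < k) (hr≡0 : h r ≡ 0) where
    open IsPermutation< perm

    private
      0<k : 0 < k
      0<k = ≤-<-trans z≤n r<k

      h₀≤n : h 0 ≤ n
      h₀≤n = ≤-trans (<⇒≤ (bounded 0 0<k)) k≤n

      r≤n : r ≤ n
      r≤n = ≤-trans (<⇒≤ r<k) k≤n

      h-positive : ∀ i → i < r → 1 ≤ h i
      h-positive i i<r = n≢0⇒n>0 (λ hi≡0 →
        <-irrefl (injective i r (<-trans i<r r<k) r<k (trans hi≡0 (sym hr≡0))) i<r)

      h≡0⇒≡r : ∀ i → i < k → h i ≡ 0 → i ≡ r
      h≡0⇒≡r i i<k hi≡0 = injective i r i<k r<k (trans hi≡0 (sym hr≡0))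

    rowSize-0 : rowSize h 0 ≡ h 0
    rowSize-0 = trans (∑-cong n (λ b _ → cong ⟦_⟧ (Bool-ext
        (λ p → <⇒<ᵇ≡true (staircase-elim h 0 b p 0 0<k z≤n))
        (λ p → staircase-intro h 0 b (λ { zero _ _ → <ᵇ≡true⇒< p })))))
      (∑-count-< n (h 0) h₀≤n)

    rowSize-≤ : ∀ a → rowSize h a ≤ h 0
    rowSize-≤ a = subst (rowSize h a ≤_) (∑-count-< n (h 0) h₀≤n) (∑-mono-≤ n (λ b _ → cell b))
      where
      cell : ∀ b → ⟦ staircase h a b ⟧ ≤ ⟦ b <ᵇ h 0 ⟧
      cell b with staircase h a b in e
      ... | false = z≤n
      ... | true rewrite <⇒<ᵇ≡true (staircase-elim h a b e 0 0<k z≤n) = ≤-refl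

    rowSize-beyond : ∀ a → r ≤ a → rowSize h a ≡ 0
    rowSize-beyond a r≤a = ∑-zero n _ (λ b _ → cong ⟦_⟧ (¬-not (λ p →
      n≮0 (subst (b <_) hr≡0 (staircase-elim h a b p r r<k r≤a)))))

    rowSize-positive : ∀ a → a < r → 1 ≤ rowSize h a
    rowSize-positive a a<r = ≤-trans (≤-reflexive (sym (cong ⟦_⟧ origin))) (m≤m+n _ _)
      where
      origin : staircase h a 0 ≡ true
      origin = staircase-intro h a 0 (λ i _ i≤a → h-positive i (≤-<-trans i≤a a<r))

    private
      r∸1≤N : r ∸ 1 ≤ N
      r∸1≤N = ≤-trans (m∸n≤m r 1) (s≤s⁻¹ (≤-trans r<k k≤n))

      rows-before-r : ∀ i → i < r ∸ 1 → 1 ≤ rowSize h (suc i)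
      rows-before-r i i<r∸1 = rowSize-positive (suc i) (subst (_< r) (+-comm i 1) (<∸⇒+< i<r∸1))

    size-lower : h 0 + r ≤ size h + 1
    size-lower = begin
      h 0 + r                   ≤⟨ +-monoʳ-≤ (h 0) (m≤n+m∸n r 1) ⟩
      h 0 + suc (r ∸ 1)         ≡⟨ trans (+-suc (h 0) (r ∸ 1)) (+-comm 1 _) ⟩
      h 0 + (r ∸ 1) + 1         ≡⟨ cong (λ x → x + (r ∸ 1) + 1) rowSize-0 ⟨
      rowSize h 0 + (r ∸ 1) + 1 ≤⟨ +-monoˡ-≤ 1 (∑-head+positive N (r ∸ 1) (rowSize h) r∸1≤N rows-before-r) ⟩
      size h + 1                ∎
      where open ≤-Reasoning

    size-lower-if-h₀≡0 : h 0 ≡ 0 → h 0 + r + 1 ≤ size h + 1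
    size-lower-if-h₀≡0 h₀≡0 rewrite h₀≡0 | sym (h≡0⇒≡r 0 0<k h₀≡0) = +-monoˡ-≤ 1 z≤n

    size-lower-if-steep : 2 ≤ h 0 → 2 ≤ h 1 → h 0 + r + 1 ≤ size h + 1
    size-lower-if-steep h₀≥2 h₁≥2 = +-monoˡ-≤ 1 (begin
      h 0 + r                 ≡⟨ cong (h 0 +_) (m+[n∸m]≡n 1≤r) ⟨
      h 0 + suc (r ∸ 1)       ≡⟨ cong (λ x → x + suc (r ∸ 1)) rowSize-0 ⟨
      rowSize h 0 + suc (r ∸ 1)
        ≤⟨ ∑-head+steep N (r ∸ 1) (rowSize h) 1≤r∸1 r∸1≤N rowSize-1 rows-before-r ⟩
      size h                  ∎)
      where
      open ≤-Reasoning
      2≤r : 2 ≤ r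
      2≤r = ≰⇒> λ r≤1 → [ r≢ h₀≥2 , r≢ h₁≥2 ]′ (n≤1⇒n≡0∨n≡1 r≤1)
        where
        r≢ : ∀ {x} → 2 ≤ h x → r ≢ x
        r≢ 2≤hx refl = <⇒≱ 2≤hx (≤-trans (≤-reflexive hr≡0) z≤n)
      1≤r : 1 ≤ r
      1≤r = ≤-trans (s≤s z≤n) 2≤r
      1≤r∸1 : 1 ≤ r ∸ 1
      1≤r∸1 = m+n≤o⇒m≤o∸n 1 2≤r
      2≤n : 2 ≤ n
      2≤n = ≤-trans h₀≥2 h₀≤n
      rowSize-1 : 2 ≤ rowSize h 1
      rowSize-1 = subst (_≤ rowSize h 1) (∑-ones 2) (∑-prefix-≤ 2 n (λ _ → 1) _ 2≤n (λ b b<2 →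
        ≤-reflexive (sym (cong ⟦_⟧ (staircase-intro h 1 b (λ
          { zero    _ _         → <-≤-trans b<2 h₀≥2
          ; (suc zero) _ _      → <-≤-trans b<2 h₁≥2
          ; (suc (suc _)) _ (s≤s ()) }))))))

    size-upper : size h ≤ r * h 0
    size-upper = begin
      size h                                      ≡⟨ cong (λ m → ∑ m (rowSize h)) (m+[n∸m]≡n r≤n) ⟨
      ∑ (r + (n ∸ r)) (rowSize h)                 ≡⟨ ∑-++ r (n ∸ r) (rowSize h) ⟩
      ∑ r (rowSize h) + ∑ (n ∸ r) (rowSize h ∘ (r +_))
        ≡⟨ cong (∑ r (rowSize h) +_) (∑-zero (n ∸ r) _ (λ i _ → rowSize-beyond (r + i) (m≤m+n r i))) ⟩
      ∑ r (rowSize h) + 0                         ≡⟨ +-identityʳ _ ⟩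
      ∑ r (rowSize h)                             ≤⟨ ∑-≤-* r (rowSize h) (h 0) (λ a _ → rowSize-≤ a) ⟩
      r * h 0                                     ∎
      where open ≤-Reasoning

    staircase-bounds : StaircaseBounds (h 0) (h 1) r (size h)
    staircase-bounds = record
      { lower          = size-lower
      ; lower-if-h₀≡0  = size-lower-if-h₀≡0
      ; lower-if-steep = size-lower-if-steep
      ; upper          = size-upper
      }

Tight : ℕ → ℕ → Set
Tight h₀ h₁ = 1 ≤ h₀ × (h₀ ≤ 1 ⊎ h₁ ≤ 1)

module _ {h₀ h₁ r z : ℕ} (bounds : StaircaseBounds h₀ h₁ r z) where
  open StaircaseBounds bounds

  tight-unless-slack : (h₀ + r + 1 ≤ z + 1 → ⊥) → Tight h₀ h₁
  tight-unless-slack no-slack = n≢0⇒n>0 (no-slack ∘ lower-if-h₀≡0) , flat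
    where
    flat : h₀ ≤ 1 ⊎ h₁ ≤ 1
    flat with h₀ ≤? 1 | h₁ ≤? 1
    ... | yes h₀≤1 | _        = inj₁ h₀≤1
    ... | no  _    | yes h₁≤1 = inj₂ h₁≤1
    ... | no  h₀≰1 | no  h₁≰1 = ⊥-elim (no-slack (lower-if-steep (≰⇒> h₀≰1) (≰⇒> h₁≰1)))

  upper-if-thin : h₀ ≡ 1 ⊎ r ≡ 1 → z + 1 ≤ h₀ + r
  upper-if-thin (inj₁ refl) = subst (_≤ 1 + r) (+-comm 1 z) (s≤s (subst (z ≤_) (*-identityʳ r) upper))
  upper-if-thin (inj₂ refl) = +-monoˡ-≤ 1 (subst (z ≤_) (+-identityʳ h₀) upper)

corner-heads+positions : ∀ K u w r s → u ≤ K → w ≤ K → r ≤ K → s ≤ K →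
  (u + r) + ((K ∸ u + s) + ((w + (K ∸ r)) + (K ∸ w + (K ∸ s)))) ≡ 4 * K
corner-heads+positions K u w r s u≤K w≤K r≤K s≤K = begin
  (u + r) + ((K ∸ u + s) + ((w + (K ∸ r)) + (K ∸ w + (K ∸ s))))
    ≡⟨ regroup u (K ∸ u) w (K ∸ w) r (K ∸ r) s (K ∸ s) ⟩
  ((u + (K ∸ u)) + (w + (K ∸ w))) + ((r + (K ∸ r)) + (s + (K ∸ s)))
    ≡⟨ cong₂ (λ x y → x + y) (cong₂ _+_ (m+[n∸m]≡n u≤K) (m+[n∸m]≡n w≤K))
                             (cong₂ _+_ (m+[n∸m]≡n r≤K) (m+[n∸m]≡n s≤K)) ⟩
  (K + K) + (K + K)
    ≡⟨ four K ⟩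
  4 * K ∎
  where
  open ≡-Reasoning
  regroup : ∀ a a' b b' x x' y y' → (a + x) + ((a' + y) + ((b + x') + (b' + y')))
                                   ≡ ((a + a') + (b + b')) + ((x + x') + (y + y'))
  regroup = solve-∀
  four : ∀ K → (K + K) + (K + K) ≡ 4 * K
  four = solve-∀

-- Corners A, B, C, D are north-west, north-east, south-west, south-east; in terms of the
-- permutation, u = q 0, w = q K, r = q⁻¹ 0, s = q⁻¹ K, x₁ = q 1 and x₂ = q (K - 1).
module FourCorners (K u w r s x₁ x₂ zA zB zC zD : ℕ)
  (u≤K : u ≤ K) (w≤K : w ≤ K) (r≤K : r ≤ K) (s≤K : s ≤ K)
  (A : StaircaseBounds u x₁ r zA) (B : StaircaseBounds (K ∸ u) (K ∸ x₁) s zB)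
  (C : StaircaseBounds w x₂ (K ∸ r) zC) (D : StaircaseBounds (K ∸ w) (K ∸ x₂) (K ∸ s) zD) where

  open StaircaseBounds

  Z : ℕ
  Z = zA + (zB + (zC + zD))

  with-slack : ∀ {eA eB eC eD} →
    u + r + eA ≤ zA + 1 → (K ∸ u) + s + eB ≤ zB + 1 → w + (K ∸ r) + eC ≤ zC + 1 → (K ∸ w) + (K ∸ s) + eD ≤ zD + 1 →
    4 * K + (eA + (eB + (eC + eD))) ≤ Z + 4
  with-slack {eA} {eB} {eC} {eD} pA pB pC pD = subst₂ _≤_
    (trans (regroup u (K ∸ u) w (K ∸ w) r s (K ∸ r) (K ∸ s) eA eB eC eD)
           (cong (_+ (eA + (eB + (eC + eD)))) (corner-heads+positions K u w r s u≤K w≤K r≤K s≤K)))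
    (add-ones zA zB zC zD)
    (+-mono-≤ pA (+-mono-≤ pB (+-mono-≤ pC pD)))
    where
    regroup : ∀ a b c d e f g h i j l m → ((a + e) + i) + (((b + f) + j) + (((c + g) + l) + ((d + h) + m)))
            ≡ ((a + e) + ((b + f) + ((c + g) + (d + h)))) + (i + (j + (l + m)))
    regroup = solve-∀
    add-ones : ∀ a b c d → (a + 1) + ((b + 1) + ((c + 1) + (d + 1))) ≡ (a + (b + (c + d))) + 4
    add-ones = solve-∀

  private
    lower₀ : ∀ {h₀ h₁ r z} → StaircaseBounds h₀ h₁ r z → h₀ + r + 0 ≤ z + 1
    lower₀ {h₀} {r = r} {z} X = subst (_≤ z + 1) (sym (+-identityʳ (h₀ + r))) (lower X)

  zeros-lower : 4 * K ≤ Z + 4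
  zeros-lower = subst (_≤ Z + 4) (+-identityʳ (4 * K)) (with-slack (lower₀ A) (lower₀ B) (lower₀ C) (lower₀ D))

  zeros-lower-K≡1 : K ≡ 1 → u ≢ w → 2 ≤ Z
  zeros-lower-K≡1 refl u≢w with u ≟ 0
  ... | yes u≡0 = +-cancelʳ-≤ 4 2 Z (with-slack (lower-if-h₀≡0 A u≡0) (lower₀ B) (lower₀ C)
                    (lower-if-h₀≡0 D (m≤n⇒m∸n≡0 (n≢0⇒n>0 (u≢w ∘ trans u≡0 ∘ sym)))))
  ... | no  u≢0 = +-cancelʳ-≤ 4 2 Z (with-slack (lower₀ A) (lower-if-h₀≡0 B (m≤n⇒m∸n≡0 (n≢0⇒n>0 u≢0)))
                    (lower-if-h₀≡0 C w≡0) (lower₀ D))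
    where
    w≡0 : w ≡ 0
    w≡0 = [ id , (λ w≡1 → ⊥-elim (u≢w (trans (≤-antisym u≤K (n≢0⇒n>0 u≢0)) (sym w≡1)))) ]′
            (n≤1⇒n≡0∨n≡1 w≤K)

  zeros-lower-K≡2 : K ≡ 2 → u ≢ w → 5 ≤ Z
  zeros-lower-K≡2 refl u≢w = +-cancelʳ-≤ 4 5 Z one-slack
    where
    one-slack : 4 * K + 1 ≤ Z + 4
    one-slack with u ≟ 0 | K ≤? u | w ≟ 0 | K ≤? w
    ... | yes u≡0 | _      | _       | _      = with-slack (lower-if-h₀≡0 A u≡0) (lower₀ B) (lower₀ C) (lower₀ D)
    ... | no _    | yes K≤u | _      | _      = with-slack (lower₀ A) (lower-if-h₀≡0 B (m≤n⇒m∸n≡0 K≤u)) (lower₀ C) (lower₀ D)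
    ... | no _    | no _   | yes w≡0 | _      = with-slack (lower₀ A) (lower₀ B) (lower-if-h₀≡0 C w≡0) (lower₀ D)
    ... | no _    | no _   | no _    | yes K≤w = with-slack (lower₀ A) (lower₀ B) (lower₀ C) (lower-if-h₀≡0 D (m≤n⇒m∸n≡0 K≤w))
    ... | no u≢0  | no K≰u | no w≢0  | no K≰w = ⊥-elim (u≢w (trans (≡1 u≢0 K≰u) (sym (≡1 w≢0 K≰w))))
      where
      ≡1 : ∀ {x} → x ≢ 0 → ¬ 2 ≤ x → x ≡ 1
      ≡1 x≢0 2≰x = ≤-antisym (s≤s⁻¹ (≰⇒> 2≰x)) (n≢0⇒n>0 x≢0)

  module _ (Z+4≡4K : Z + 4 ≡ 4 * K) where
    private
      no-slack : 4 * K + 1 ≤ Z + 4 → ⊥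
      no-slack p = <-irrefl refl (subst (4 * K <_) Z+4≡4K (subst (_≤ Z + 4) (+-comm (4 * K) 1) p))

    tight-corners : Tight u x₁ × Tight (K ∸ u) (K ∸ x₁) × Tight w x₂ × Tight (K ∸ w) (K ∸ x₂)
    tight-corners =
      tight-unless-slack A (λ p → no-slack (with-slack p (lower₀ B) (lower₀ C) (lower₀ D))) ,
      tight-unless-slack B (λ p → no-slack (with-slack (lower₀ A) p (lower₀ C) (lower₀ D))) ,
      tight-unless-slack C (λ p → no-slack (with-slack (lower₀ A) (lower₀ B) p (lower₀ D))) ,
      tight-unless-slack D (λ p → no-slack (with-slack (lower₀ A) (lower₀ B) (lower₀ C) p))

  zeros-upper : (u ≡ 1 ⊎ r ≡ 1) → (K ∸ u ≡ 1 ⊎ s ≡ 1) → (w ≡ 1 ⊎ K ∸ r ≡ 1) → (K ∸ w ≡ 1 ⊎ K ∸ s ≡ 1) →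
    Z + 4 ≤ 4 * K
  zeros-upper tA tB tC tD = subst₂ _≤_ (add-ones zA zB zC zD) (corner-heads+positions K u w r s u≤K w≤K r≤K s≤K)
    (+-mono-≤ (upper-if-thin A tA) (+-mono-≤ (upper-if-thin B tB) (+-mono-≤ (upper-if-thin C tC) (upper-if-thin D tD))))
    where
    add-ones : ∀ a b c d → (a + 1) + ((b + 1) + ((c + 1) + (d + 1))) ≡ (a + (b + (c + d))) + 4
    add-ones = solve-∀

private
  ∸≤1⇒∸1≤ : ∀ {K x} → x ≤ K → K ∸ x ≤ 1 → K ∸ 1 ≤ x
  ∸≤1⇒∸1≤ {K} {x} x≤K p = m≤n+o⇒m∸n≤o K 1 (subst (_≤ 1 + x) (m∸n+n≡m x≤K) (+-monoˡ-≤ x p))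

  1≤∸⇒≤∸1 : ∀ {K x} → 1 ≤ K ∸ x → x ≤ K ∸ 1
  1≤∸⇒≤∸1 {K} {x} p = m+n≤o⇒m≤o∸n x (subst (_≤ K) (+-comm 1 x) (<∸⇒+< {0} p))

  ≤1-∸1≤-absurd : ∀ {K x} → 3 ≤ K → x ≤ 1 → K ∸ 1 ≤ x → ⊥
  ≤1-∸1≤-absurd (s≤s (s≤s (s≤s _))) (s≤s z≤n) (s≤s ())
  ≤1-∸1≤-absurd (s≤s (s≤s (s≤s _))) z≤n ()

  ≤1-≢1⇒≡0 : ∀ {x} → x ≤ 1 → x ≢ 1 → x ≡ 0
  ≤1-≢1⇒≡0 z≤n       _   = refl
  ≤1-≢1⇒≡0 (s≤s z≤n) x≢1 = ⊥-elim (x≢1 refl)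

  ∸1≤-≢∸1⇒≡ : ∀ {K x} → 1 ≤ K → K ∸ 1 ≤ x → x ≤ K → x ≢ K ∸ 1 → x ≡ K
  ∸1≤-≢∸1⇒≡ {suc K} _ K≤x x≤1+K x≢K = ≤-antisym x≤1+K (≤∧≢⇒< K≤x (x≢K ∘ sym))

tight-corners⇒pattern : ∀ K u w x₁ x₂ → 3 ≤ K → u ≤ K → w ≤ K → x₁ ≤ K → x₂ ≤ K →
  u ≢ w → u ≢ x₁ → u ≢ x₂ → w ≢ x₁ → w ≢ x₂ →
  Tight u x₁ → Tight (K ∸ u) (K ∸ x₁) → Tight w x₂ → Tight (K ∸ w) (K ∸ x₂) →
  (u ≡ 1 × x₁ ≡ K × w ≡ K ∸ 1 × x₂ ≡ 0) ⊎ (x₁ ≡ 0 × w ≡ 1 × x₂ ≡ K × u ≡ K ∸ 1)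
tight-corners⇒pattern K u w x₁ x₂ 3≤K u≤K w≤K x₁≤K x₂≤K u≢w u≢x₁ u≢x₂ w≢x₁ w≢x₂
  (1≤u , tA) (1≤K∸u , tB) (1≤w , tC) (1≤K∸w , tD) with u ≤? 1
... | yes u≤1 = inj₁ (u≡1 , x₁≡K , w≡K∸1 , x₂≡0)
  where
  u≡1 : u ≡ 1
  u≡1 = ≤-antisym u≤1 1≤u
  x₂≤1 : x₂ ≤ 1
  x₂≤1 = [ (λ w≤1 → ⊥-elim (u≢w (trans u≡1 (sym (≤-antisym w≤1 1≤w))))) , id ]′ tC
  w≡K∸1 : w ≡ K ∸ 1
  w≡K∸1 = [ (λ p → ≤-antisym (1≤∸⇒≤∸1 1≤K∸w) (∸≤1⇒∸1≤ w≤K p)) ,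
            (λ p → ⊥-elim (≤1-∸1≤-absurd 3≤K x₂≤1 (∸≤1⇒∸1≤ x₂≤K p))) ]′ tD
  x₂≡0 : x₂ ≡ 0
  x₂≡0 = ≤1-≢1⇒≡0 x₂≤1 (u≢x₂ ∘ trans u≡1 ∘ sym)
  x₁≡K : x₁ ≡ K
  x₁≡K = ∸1≤-≢∸1⇒≡ (≤-trans (s≤s z≤n) 3≤K)
    ([ (λ p → ⊥-elim (≤1-∸1≤-absurd 3≤K u≤1 (∸≤1⇒∸1≤ u≤K p))) , ∸≤1⇒∸1≤ x₁≤K ]′ tB)
    x₁≤K (w≢x₁ ∘ trans w≡K∸1 ∘ sym)
... | no u≰1 = inj₂ (x₁≡0 , w≡1 , x₂≡K , u≡K∸1)
  where
  x₁≤1 : x₁ ≤ 1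
  x₁≤1 = [ (λ u≤1 → ⊥-elim (u≰1 u≤1)) , id ]′ tA
  u≡K∸1 : u ≡ K ∸ 1
  u≡K∸1 = [ (λ p → ≤-antisym (1≤∸⇒≤∸1 1≤K∸u) (∸≤1⇒∸1≤ u≤K p)) ,
            (λ p → ⊥-elim (≤1-∸1≤-absurd 3≤K x₁≤1 (∸≤1⇒∸1≤ x₁≤K p))) ]′ tB
  K∸1≤x₂ : K ∸ 1 ≤ x₂
  K∸1≤x₂ = [ (λ p → ⊥-elim (u≢w (trans u≡K∸1 (sym (≤-antisym (1≤∸⇒≤∸1 1≤K∸w) (∸≤1⇒∸1≤ w≤K p)))))) ,
             ∸≤1⇒∸1≤ x₂≤K ]′ tD
  w≡1 : w ≡ 1
  w≡1 = [ (λ w≤1 → ≤-antisym w≤1 1≤w) , (λ x₂≤1 → ⊥-elim (≤1-∸1≤-absurd 3≤K x₂≤1 K∸1≤x₂)) ]′ tC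
  x₁≡0 : x₁ ≡ 0
  x₁≡0 = ≤1-≢1⇒≡0 x₁≤1 (w≢x₁ ∘ trans w≡1 ∘ sym)
  x₂≡K : x₂ ≡ K
  x₂≡K = ∸1≤-≢∸1⇒≡ (≤-trans (s≤s z≤n) 3≤K) K∸1≤x₂ x₂≤K (u≢x₂ ∘ trans u≡K∸1 ∘ sym)

-- The minimal forcing matrix

module Geometry (K d : ℕ) (k≤d : suc K ≤ d) (q : ℕ → ℕ) (perm : IsPermutation< (suc K) q) where
  open IsPermutation< perm

  k N : ℕ
  k = suc K
  N = K + d

  open Staircase k N (s≤s (m≤m+n K d)) public

  covered : ℕ → ℕ → Bool
  covered a b = any< k (λ i → (i ≤ᵇ a) ∧ ((a ≤ᵇ i + d) ∧ ((q i ≤ᵇ b) ∧ (b ≤ᵇ q i + d))))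

  covered-intro : ∀ a b i → i < k → i ≤ a → a ≤ i + d → q i ≤ b → b ≤ q i + d → covered a b ≡ true
  covered-intro a b i i<k p₁ p₂ p₃ p₄ = any<-intro k _ i i<k
    (∧-intro (≤⇒≤ᵇ≡true p₁) (∧-intro (≤⇒≤ᵇ≡true p₂) (∧-intro (≤⇒≤ᵇ≡true p₃) (≤⇒≤ᵇ≡true p₄))))

  covered-elim : ∀ a b → covered a b ≡ true →
    Σ ℕ λ i → i < k × i ≤ a × a ≤ i + d × q i ≤ b × b ≤ q i + d
  covered-elim a b p with any<-elim k _ p
  ... | i , i<k , e = i , i<k , ≤ᵇ≡true⇒≤ (∧-projₗ _ e) , ≤ᵇ≡true⇒≤ (∧-projₗ _ e₂) ,
                      ≤ᵇ≡true⇒≤ (∧-projₗ _ e₃) , ≤ᵇ≡true⇒≤ (∧-projᵣ (q i ≤ᵇ b) e₃)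
    where
    e₂ : ((a ≤ᵇ i + d) ∧ ((q i ≤ᵇ b) ∧ (b ≤ᵇ q i + d))) ≡ true
    e₂ = ∧-projᵣ (i ≤ᵇ a) e
    e₃ : ((q i ≤ᵇ b) ∧ (b ≤ᵇ q i + d)) ≡ true
    e₃ = ∧-projᵣ (a ≤ᵇ i + d) e₂

  covered≡false : ∀ a b → covered a b ≡ false → ∀ i → i < k → i ≤ a → a ≤ i + d → q i ≤ b → q i + d < b
  covered≡false a b c i i<k p₁ p₂ p₃ = ≰⇒> (not-¬ c ∘ covered-intro a b i i<k p₁ p₂ p₃)

  -- The north-east, south-west and south-east corners are north-west staircases of these
  -- reflections of q, read with the columns and/or rows of the n × n grid reversed.
  qᶜ qʳ qʳᶜ : ℕ → ℕ
  qᶜ i  = K ∸ q i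
  qʳ i  = q (K ∸ i)
  qʳᶜ i = K ∸ q (K ∸ i)

  private
    K∸K∸ : ∀ {j} → j < k → K ∸ (K ∸ j) ≡ j
    K∸K∸ j<k = m∸[m∸n]≡n (s≤s⁻¹ j<k)

    K∸<k : ∀ j → K ∸ j < k
    K∸<k j = s≤s (m∸n≤m K j)

    q≤K : ∀ i → i < k → q i ≤ K
    q≤K i i<k = s≤s⁻¹ (bounded i i<k)

    K≤d : K ≤ d
    K≤d = <⇒≤ k≤d

    reflected-row : ∀ {a i} → a ≤ N → i < k → i ≤ N ∸ a → a ≤ (K ∸ i) + d
    reflected-row {a} {i} a≤N i<k i≤ = Equivalence.to (reflect-≤ K d a≤N (m∸n≤m K i))
      (subst (_≤ N ∸ a) (sym (K∸K∸ i<k)) i≤)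

  ne-elim : ∀ a b → b ≤ N → staircase qᶜ a (N ∸ b) ≡ true → ∀ i → i < k → i ≤ a → q i + d < b
  ne-elim a b b≤N p i i<k i≤a = Equivalence.to (reflect-< K d b≤N) (staircase-elim qᶜ a (N ∸ b) p i i<k i≤a)

  ne-intro : ∀ a b → b ≤ N → (∀ i → i < k → i ≤ a → q i + d < b) → staircase qᶜ a (N ∸ b) ≡ true
  ne-intro a b b≤N H = staircase-intro qᶜ a (N ∸ b) λ i i<k i≤a →
    Equivalence.from (reflect-< K d b≤N) (H i i<k i≤a)

  sw-elim : ∀ a b → a ≤ N → staircase qʳ (N ∸ a) b ≡ true → ∀ j → j < k → a ≤ j + d → b < q j
  sw-elim a b a≤N p j j<k a≤ = subst (λ x → b < q x) (K∸K∸ j<k)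
    (staircase-elim qʳ (N ∸ a) b p (K ∸ j) (K∸<k j) (Equivalence.from (reflect-≤ K d a≤N (s≤s⁻¹ j<k)) a≤))

  se-elim : ∀ a b → a ≤ N → b ≤ N → staircase qʳᶜ (N ∸ a) (N ∸ b) ≡ true →
    ∀ j → j < k → a ≤ j + d → q j + d < b
  se-elim a b a≤N b≤N p j j<k a≤ = Equivalence.to (reflect-< K d b≤N) (subst (λ x → N ∸ b < K ∸ q x) (K∸K∸ j<k)
    (staircase-elim qʳᶜ (N ∸ a) (N ∸ b) p (K ∸ j) (K∸<k j) (Equivalence.from (reflect-≤ K d a≤N (s≤s⁻¹ j<k)) a≤)))

  se-intro : ∀ a b → a ≤ N → b ≤ N → (∀ j → j < k → a ≤ j + d → q j + d < b) →
    staircase qʳᶜ (N ∸ a) (N ∸ b) ≡ true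
  se-intro a b a≤N b≤N H = staircase-intro qʳᶜ (N ∸ a) (N ∸ b) λ i i<k i≤ →
    Equivalence.from (reflect-< K d b≤N) (H (K ∸ i) (K∸<k i) (reflected-row a≤N i<k i≤))

  i₀ iK : ℕ
  i₀ = proj₁ (surjective 0 z<s)
  iK = proj₁ (surjective K ≤-refl)

  i₀<k : i₀ < k
  i₀<k = proj₁ (proj₂ (surjective 0 z<s))

  iK<k : iK < k
  iK<k = proj₁ (proj₂ (surjective K ≤-refl))

  q[i₀]≡0 : q i₀ ≡ 0
  q[i₀]≡0 = proj₂ (proj₂ (surjective 0 z<s))

  q[iK]≡K : q iK ≡ K
  q[iK]≡K = proj₂ (proj₂ (surjective K ≤-refl))

  cell : ℕ → ℕ → ℕ
  cell a b = ⟦ covered a b ⟧ + (⟦ staircase q a b ⟧ + (⟦ staircase qᶜ a (N ∸ b) ⟧ +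
             (⟦ staircase qʳ (N ∸ a) b ⟧ + ⟦ staircase qʳᶜ (N ∸ a) (N ∸ b) ⟧)))

  private
    nw-beyond-i₀ : ∀ a b → i₀ ≤ a → staircase q a b ≡ false
    nw-beyond-i₀ a b i₀≤a = ¬-not λ p → n≮0 (subst (b <_) q[i₀]≡0 (staircase-elim q a b p i₀ i₀<k i₀≤a))

    ne-beyond-iK : ∀ a b → b ≤ N → iK ≤ a → staircase qᶜ a (N ∸ b) ≡ false
    ne-beyond-iK a b b≤N iK≤a = ¬-not λ p →
      <⇒≱ (subst (λ x → x + d < b) q[iK]≡K (ne-elim a b b≤N p iK iK<k iK≤a)) b≤N

    sw-above-i₀ : ∀ a b → a ≤ N → a ≤ i₀ + d → staircase qʳ (N ∸ a) b ≡ false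
    sw-above-i₀ a b a≤N a≤ = ¬-not λ p → n≮0 (subst (b <_) q[i₀]≡0 (sw-elim a b a≤N p i₀ i₀<k a≤))

    se-above-iK : ∀ a b → a ≤ N → b ≤ N → a ≤ iK + d → staircase qʳᶜ (N ∸ a) (N ∸ b) ≡ false
    se-above-iK a b a≤N b≤N a≤ = ¬-not λ p →
      <⇒≱ (subst (λ x → x + d < b) q[iK]≡K (se-elim a b a≤N b≤N p iK iK<k a≤)) b≤N

    -- Boxes start in columns ≤ K ≤ d < b, so b can only miss a box meeting row a on its right.
    right-of-all : ∀ a b → covered a b ≡ false → d < b → ∀ i → i < k → i ≤ a → a ≤ i + d → q i + d < b
    right-of-all a b c d<b i i<k p₁ p₂ with q i ≤? b
    ... | yes qi≤b = covered≡false a b c i i<k p₁ p₂ qi≤b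
    ... | no  qi≰b = ⊥-elim (<-asym d<b (<-≤-trans (≰⇒> qi≰b) (≤-trans (q≤K i i<k) K≤d)))

  cell-covered : ∀ a b → a ≤ N → b ≤ N → covered a b ≡ true → cell a b ≡ 1
  cell-covered a b a≤N b≤N c with covered-elim a b c
  ... | i , i<k , p₁ , p₂ , p₃ , p₄
    rewrite c
          | ¬-not {staircase q a b} (λ p → <⇒≱ (staircase-elim q a b p i i<k p₁) p₃)
          | ¬-not {staircase qᶜ a (N ∸ b)} (λ p → <⇒≱ (ne-elim a b b≤N p i i<k p₁) p₄)
          | ¬-not {staircase qʳ (N ∸ a) b} (λ p → <⇒≱ (sw-elim a b a≤N p i i<k p₂) p₃)
          | ¬-not {staircase qʳᶜ (N ∸ a) (N ∸ b)} (λ p → <⇒≱ (se-elim a b a≤N b≤N p i i<k p₂) p₄) = refl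

  cell-top : ∀ a b → a < K → b ≤ N → covered a b ≡ false → cell a b ≡ 1
  cell-top a b a<K b≤N c = nw-or-ne
    where
    a≤N : a ≤ N
    a≤N = ≤-trans (<⇒≤ a<K) (m≤m+n K d)
    every-row : ∀ j → a ≤ j + d
    every-row j = ≤-trans (<⇒≤ a<K) (≤-trans K≤d (m≤n+m d j))
    nw-or-ne : cell a b ≡ 1
    nw-or-ne rewrite c | sw-above-i₀ a b a≤N (every-row i₀) | se-above-iK a b a≤N b≤N (every-row iK)
      with staircase q a b in nw
    ... | true rewrite ¬-not {staircase qᶜ a (N ∸ b)} (λ p → <⇒≱ (staircase-elim q a b nw 0 z<s z≤n)
            (≤-trans (m≤m+n (q 0) d) (<⇒≤ (ne-elim a b b≤N p 0 z<s z≤n)))) = refl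
    ... | false with staircase≡false q a b nw
    ...   | i₁ , i₁<k , i₁≤a , qi₁≤b rewrite ne-intro a b b≤N (λ i i<k i≤a → right-of-all a b c
            (≤-<-trans (m≤n+m d _) (covered≡false a b c i₁ i₁<k i₁≤a (every-row i₁) qi₁≤b)) i i<k i≤a (every-row i)) = refl

  cell-bottom : ∀ a b → a ≤ N → d < a → b ≤ N → covered a b ≡ false → cell a b ≡ 1
  cell-bottom a b a≤N d<a b≤N c = sw-or-se
    where
    every-col : ∀ i → i < k → i ≤ a
    every-col i i<k = ≤-trans (s≤s⁻¹ i<k) (≤-trans K≤d (<⇒≤ d<a))
    sw-or-se : cell a b ≡ 1
    sw-or-se rewrite c | nw-beyond-i₀ a b (every-col i₀ i₀<k) | ne-beyond-iK a b b≤N (every-col iK iK<k)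
      with staircase qʳ (N ∸ a) b in sw
    ... | true rewrite ¬-not {staircase qʳᶜ (N ∸ a) (N ∸ b)} (λ p → <⇒≱ (sw-elim a b a≤N sw K ≤-refl a≤N)
            (≤-trans (m≤m+n (q K) d) (<⇒≤ (se-elim a b a≤N b≤N p K ≤-refl a≤N)))) = refl
    ... | false with staircase≡false qʳ (N ∸ a) b sw
    ...   | i , i<k , i≤ , qʳi≤b rewrite se-intro a b a≤N b≤N (λ j j<k a≤ → right-of-all a b c (≤-<-trans (m≤n+m d _)
            (covered≡false a b c (K ∸ i) (K∸<k i) (every-col (K ∸ i) (K∸<k i)) (reflected-row a≤N i<k i≤) qʳi≤b))
            j j<k (every-col j j<k) a≤) = refl

  middle-rows-covered : ∀ a b → K ≤ a → a ≤ d → b ≤ N → covered a b ≡ true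
  middle-rows-covered a b K≤a a≤d b≤N with b ≤? K
  ... | yes b≤K = let (i , i<k , qi≡b) = surjective b (s≤s b≤K) in
    covered-intro a b i i<k (≤-trans (s≤s⁻¹ i<k) K≤a) (≤-trans a≤d (m≤n+m d i))
      (≤-reflexive qi≡b) (subst (λ x → b ≤ x + d) (sym qi≡b) (m≤m+n b d))
  ... | no  b≰K = covered-intro a b iK iK<k (≤-trans (s≤s⁻¹ iK<k) K≤a) (≤-trans a≤d (m≤n+m d iK))
      (subst (_≤ b) (sym q[iK]≡K) (<⇒≤ (≰⇒> b≰K))) (subst (λ x → b ≤ x + d) (sym q[iK]≡K) b≤N)

  cell≡1 : ∀ a b → a ≤ N → b ≤ N → cell a b ≡ 1
  cell≡1 a b a≤N b≤N = by-cases (covered a b) refl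
    where
    by-cases : ∀ x → covered a b ≡ x → cell a b ≡ 1
    by-cases true  c = cell-covered a b a≤N b≤N c
    by-cases false c with a <? K | d <? a
    ... | yes a<K | _       = cell-top a b a<K b≤N c
    ... | no  _   | yes d<a = cell-bottom a b a≤N d<a b≤N c
    ... | no  a≮K | no  d≮a = contradiction (middle-rows-covered a b (≮⇒≥ a≮K) (≮⇒≥ d≮a) b≤N) (not-¬ c)

  grid : (ℕ → ℕ → ℕ) → ℕ
  grid f = ∑ n (λ a → ∑ n (f a))

  private
    grid-+ : ∀ f g → grid (λ a b → f a b + g a b) ≡ grid f + grid g
    grid-+ f g = trans (∑-cong n (λ a _ → ∑-distrib-+ n (f a) (g a))) (∑-distrib-+ n (λ a → ∑ n (f a)) (λ a → ∑ n (g a)))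

    grid-reverse-columns : ∀ f → grid (λ a b → f a (N ∸ b)) ≡ grid f
    grid-reverse-columns f = ∑-cong n (λ a _ → ∑-reverse n (f a))

    grid-reverse-rows : ∀ f → grid (λ a b → f (N ∸ a) b) ≡ grid f
    grid-reverse-rows f = ∑-reverse n (λ a → ∑ n (f a))

  ones-covered : ℕ
  ones-covered = grid (λ a b → ⟦ covered a b ⟧)

  zeros : ℕ
  zeros = size q + (size qᶜ + (size qʳ + size qʳᶜ))

  private
    nw ne sw se corners : ℕ → ℕ → ℕ
    nw a b = ⟦ staircase q a b ⟧
    ne a b = ⟦ staircase qᶜ a (N ∸ b) ⟧
    sw a b = ⟦ staircase qʳ (N ∸ a) b ⟧
    se a b = ⟦ staircase qʳᶜ (N ∸ a) (N ∸ b) ⟧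
    corners a b = nw a b + (ne a b + (sw a b + se a b))

    grid-corners : grid corners ≡ zeros
    grid-corners = begin
      grid corners                                        ≡⟨ grid-+ nw (λ a b → ne a b + (sw a b + se a b)) ⟩
      grid nw + grid (λ a b → ne a b + (sw a b + se a b)) ≡⟨ cong (grid nw +_) (grid-+ ne (λ a b → sw a b + se a b)) ⟩
      grid nw + (grid ne + grid (λ a b → sw a b + se a b)) ≡⟨ cong (λ x → grid nw + (grid ne + x)) (grid-+ sw se) ⟩
      grid nw + (grid ne + (grid sw + grid se))
        ≡⟨ cong₂ (λ x y → size q + (x + y)) (grid-reverse-columns (λ a b → ⟦ staircase qᶜ a b ⟧))
             (cong₂ _+_ (grid-reverse-rows (λ a b → ⟦ staircase qʳ a b ⟧))
               (trans (grid-reverse-rows (λ a b → ⟦ staircase qʳᶜ a (N ∸ b) ⟧))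
                      (grid-reverse-columns (λ a b → ⟦ staircase qʳᶜ a b ⟧)))) ⟩
      zeros                                               ∎
      where open ≡-Reasoning

  ones-covered+zeros : ones-covered + zeros ≡ n * n
  ones-covered+zeros = begin
    ones-covered + zeros          ≡⟨ cong (ones-covered +_) grid-corners ⟨
    ones-covered + grid corners   ≡⟨ grid-+ (λ a b → ⟦ covered a b ⟧) corners ⟨
    grid cell                     ≡⟨ ∑-cong n (λ a a<n → trans (∑-cong n (λ b b<n →
                                       cell≡1 a b (s≤s⁻¹ a<n) (s≤s⁻¹ b<n))) (∑-ones n)) ⟩
    ∑ n (λ _ → n)                 ≡⟨ ∑-const n n ⟩
    n * n                         ∎
    where open ≡-Reasoning

  nw-bounds : StaircaseBounds (q 0) (q 1) i₀ (size q)
  nw-bounds = staircase-bounds q perm i₀ i₀<k q[i₀]≡0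

  ne-bounds : StaircaseBounds (K ∸ q 0) (K ∸ q 1) iK (size qᶜ)
  ne-bounds = staircase-bounds qᶜ (complement-permutation perm) iK iK<k (trans (cong (K ∸_) q[iK]≡K) (n∸n≡0 K))

  sw-bounds : StaircaseBounds (q K) (q (K ∸ 1)) (K ∸ i₀) (size qʳ)
  sw-bounds = staircase-bounds qʳ (reverse-permutation perm) (K ∸ i₀) (K∸<k i₀)
    (trans (cong q (K∸K∸ i₀<k)) q[i₀]≡0)

  se-bounds : StaircaseBounds (K ∸ q K) (K ∸ q (K ∸ 1)) (K ∸ iK) (size qʳᶜ)
  se-bounds = staircase-bounds qʳᶜ (complement-permutation (reverse-permutation perm)) (K ∸ iK) (K∸<k iK)
    (trans (cong (λ x → K ∸ q x) (K∸K∸ iK<k)) (trans (cong (K ∸_) q[iK]≡K) (n∸n≡0 K)))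

  open FourCorners K (q 0) (q K) i₀ iK (q 1) (q (K ∸ 1)) (size q) (size qᶜ) (size qʳ) (size qʳᶜ)
    (q≤K 0 z<s) (q≤K K ≤-refl) (s≤s⁻¹ i₀<k) (s≤s⁻¹ iK<k) nw-bounds ne-bounds sw-bounds se-bounds
    public using (zeros-lower; zeros-lower-K≡1; zeros-lower-K≡2; tight-corners; zeros-upper)

  zeros-≤ : ∀ {a b c e} → q 0 ≡ a → q K ≡ b → i₀ ≡ c → iK ≡ e →
    zeros ≤ c * a + (e * (K ∸ a) + ((K ∸ c) * b + (K ∸ e) * (K ∸ b)))
  zeros-≤ refl refl refl refl =
    +-mono-≤ (upper nw-bounds) (+-mono-≤ (upper ne-bounds) (+-mono-≤ (upper sw-bounds) (upper se-bounds)))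
    where open StaircaseBounds

  i₀-unique : ∀ {c} → c < k → q c ≡ 0 → i₀ ≡ c
  i₀-unique c<k qc≡0 = injective i₀ _ i₀<k c<k (trans q[i₀]≡0 (sym qc≡0))

  iK-unique : ∀ {c} → c < k → q c ≡ K → iK ≡ c
  iK-unique c<k qc≡K = injective iK _ iK<k c<k (trans q[iK]≡K (sym qc≡K))

  q0≢qK : 1 ≤ K → q 0 ≢ q K
  q0≢qK 1≤K = <⇒≢ 1≤K ∘ injective 0 K z<s ≤-refl

  Pattern₁ Pattern₂ : Set
  Pattern₁ = q 0 ≡ 1 × q 1 ≡ K × q K ≡ K ∸ 1 × q (K ∸ 1) ≡ 0
  Pattern₂ = q 1 ≡ 0 × q K ≡ 1 × q (K ∸ 1) ≡ K × q 0 ≡ K ∸ 1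

  module _ (3≤K : 3 ≤ K) where
    private
      1<k : 1 < k
      1<k = s≤s (≤-trans (s≤s z≤n) 3≤K)

      K∸1<k : K ∸ 1 < k
      K∸1<k = K∸<k 1

      K∸[K∸1]≡1 : K ∸ (K ∸ 1) ≡ 1
      K∸[K∸1]≡1 = K∸K∸ 1<k

      q-distinct : ∀ i j → i < k → j < k → i ≢ j → q i ≢ q j
      q-distinct i j i<k j<k i≢j = i≢j ∘ injective i j i<k j<k

      K≢1 : K ≢ 1
      K≢1 = <⇒≢ (≤-trans (s≤s (s≤s z≤n)) 3≤K) ∘ sym

      K∸1≢0 : K ∸ 1 ≢ 0
      K∸1≢0 = m>n⇒m∸n≢0 (≤-trans (s≤s (s≤s z≤n)) 3≤K)

      K∸1≢K : K ∸ 1 ≢ K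
      K∸1≢K = <⇒≢ (∸-monoʳ-< z<s (≤-trans (s≤s z≤n) 3≤K))

    zeros-tight⇒pattern : zeros + 4 ≡ 4 * K → Pattern₁ ⊎ Pattern₂
    zeros-tight⇒pattern Z+4≡4K =
      let (tA , tB , tC , tD) = tight-corners Z+4≡4K in
      tight-corners⇒pattern K (q 0) (q K) (q 1) (q (K ∸ 1)) 3≤K
      (q≤K 0 z<s) (q≤K K ≤-refl) (q≤K 1 1<k) (q≤K (K ∸ 1) K∸1<k)
      (q0≢qK (≤-trans (s≤s z≤n) 3≤K)) (q-distinct 0 1 z<s 1<k λ ()) (q-distinct 0 (K ∸ 1) z<s K∸1<k (K∸1≢0 ∘ sym))
      (q-distinct K 1 ≤-refl 1<k K≢1) (q-distinct K (K ∸ 1) ≤-refl K∸1<k (K∸1≢K ∘ sym))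
      tA tB tC tD

    pattern⇒zeros-tight : Pattern₁ ⊎ Pattern₂ → zeros + 4 ≤ 4 * K
    pattern⇒zeros-tight (inj₁ (q0≡1 , q1≡K , qK≡K∸1 , qK∸1≡0)) = zeros-upper
      (inj₁ q0≡1)
      (inj₂ (injective iK 1 iK<k 1<k (trans q[iK]≡K (sym q1≡K))))
      (inj₂ (trans (cong (K ∸_) (injective i₀ (K ∸ 1) i₀<k K∸1<k (trans q[i₀]≡0 (sym qK∸1≡0)))) K∸[K∸1]≡1))
      (inj₁ (trans (cong (K ∸_) qK≡K∸1) K∸[K∸1]≡1))
    pattern⇒zeros-tight (inj₂ (q1≡0 , qK≡1 , qK∸1≡K , q0≡K∸1)) = zeros-upper
      (inj₂ (injective i₀ 1 i₀<k 1<k (trans q[i₀]≡0 (sym q1≡0))))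
      (inj₁ (trans (cong (K ∸_) q0≡K∸1) K∸[K∸1]≡1))
      (inj₁ qK≡1)
      (inj₂ (trans (cong (K ∸_) (injective iK (K ∸ 1) iK<k K∸1<k (trans q[iK]≡K (sym qK∸1≡K)))) K∸[K∸1]≡1))

increasing-≥ : ∀ {k n} (f : Fin k → Fin n) → Increasing f → ∀ x → toℕ x ≤ toℕ (f x)
increasing-≥ f inc fzero    = z≤n
increasing-≥ f inc (fsuc x) = ≤-<-trans (increasing-≥ (f ∘ inject₁) inject₁-inc x)
  (inc (inject₁ x) (fsuc x) (s≤s (≤-reflexive (toℕ-inject₁ x))))
  where
  inject₁-inc : Increasing (f ∘ inject₁)
  inject₁-inc i j i<j = inc (inject₁ i) (inject₁ j) (subst₂ _<_ (sym (toℕ-inject₁ i)) (sym (toℕ-inject₁ j)) i<j)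

increasing-room-above : ∀ {k n} (f : Fin k → Fin n) → Increasing f → ∀ x → toℕ (f x) + (k ∸ suc (toℕ x)) < n
increasing-room-above {suc zero}    f inc fzero = subst (_< _) (sym (+-identityʳ _)) (toℕ<n (f fzero))
increasing-room-above {suc (suc k)} f inc fzero = begin-strict
  toℕ (f fzero) + suc k      ≡⟨ +-suc (toℕ (f fzero)) k ⟩
  suc (toℕ (f fzero) + k)    ≤⟨ +-monoˡ-≤ k (inc fzero (fsuc fzero) z<s) ⟩
  toℕ (f (fsuc fzero)) + k   <⟨ increasing-room-above (f ∘ fsuc) (λ i j → inc (fsuc i) (fsuc j) ∘ s<s) fzero ⟩
  _                          ∎
  where open ≤-Reasoning
increasing-room-above {suc k} f inc (fsuc x) = increasing-room-above (f ∘ fsuc) (λ i j → inc (fsuc i) (fsuc j) ∘ s<s) x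

increasing-≤ : ∀ {k} d (f : Fin k → Fin (k + d)) → Increasing f → ∀ x → toℕ (f x) ≤ toℕ x + d
increasing-≤ {k} d f inc x = +-cancelʳ-≤ room _ _ (s≤s⁻¹ (begin-strict
  toℕ (f x) + room                 <⟨ increasing-room-above f inc x ⟩
  k + d                            ≡⟨ cong (_+ d) (m+[n∸m]≡n (toℕ<n x)) ⟨
  suc (toℕ x) + room + d           ≡⟨ rearrange (toℕ x) room d ⟩
  suc (toℕ x + d + room)           ∎))
  where
  open ≤-Reasoning
  room : ℕ
  room = k ∸ suc (toℕ x)
  rearrange : ∀ a b c → suc a + b + c ≡ suc (a + c + b)
  rearrange = solve-∀

module _ (i s : ℕ) where

  shift-from : ℕ → ℕ
  shift-from x with x <? i
  ... | yes _ = x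
  ... | no  _ = x + s

  shift-from-< : ∀ {x y} → x < y → shift-from x < shift-from y
  shift-from-< {x} {y} x<y with x <? i | y <? i
  ... | yes _   | yes _   = x<y
  ... | yes x<i | no  y≮i = <-≤-trans x<i (≤-trans (≮⇒≥ y≮i) (m≤m+n y s))
  ... | no  x≮i | yes y<i = ⊥-elim (x≮i (<-trans x<y y<i))
  ... | no  _   | no  _   = +-monoˡ-< s x<y

  shift-from-≤ : ∀ x → shift-from x ≤ x + s
  shift-from-≤ x with x <? i
  ... | yes _ = m≤m+n x s
  ... | no  _ = ≤-refl

  shift-from-i : shift-from i ≡ i + s
  shift-from-i with i <? i
  ... | yes i<i = ⊥-elim (<-irrefl refl i<i)
  ... | no  _   = refl

increasing-through : ∀ {k} d i a → i ≤ a → a ≤ i + d →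
  Σ (Fin k → Fin (k + d)) λ f → Increasing f × (∀ x → toℕ x ≡ i → toℕ (f x) ≡ a)
increasing-through {k} d i a i≤a a≤i+d = f , f-inc , f-at-i
  where
  s : ℕ
  s = a ∸ i
  f : Fin k → Fin (k + d)
  f x = fromℕ< (≤-<-trans (shift-from-≤ i s (toℕ x)) (+-mono-<-≤ (toℕ<n x) (m≤n+o⇒m∸n≤o a i a≤i+d)))
  f-inc : Increasing f
  f-inc x y x<y = subst₂ _<_ (sym (toℕ-fromℕ< _)) (sym (toℕ-fromℕ< _)) (shift-from-< i s x<y)
  f-at-i : ∀ x → toℕ x ≡ i → toℕ (f x) ≡ a
  f-at-i x refl = trans (toℕ-fromℕ< _) (trans (shift-from-i (toℕ x) s) (m+[n∸m]≡n i≤a))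

inverses⇒permutation : ∀ {k} (f g : ℕ → ℕ) → (∀ i → i < k → f i < k) → (∀ j → j < k → g j < k) →
  (∀ i → i < k → g (f i) ≡ i) → (∀ j → j < k → f (g j) ≡ j) → IsPermutation< k f
inverses⇒permutation f g f<k g<k gf fg = record
  { bounded    = f<k
  ; surjective = λ j j<k → g j , g<k j j<k , fg j j<k
  ; injective  = λ i j i<k j<k e → trans (sym (gf i i<k)) (trans (cong g e) (gf j j<k))
  }

permutationMatrix : ∀ k → (ℕ → ℕ) → Matrix k k
permutationMatrix k f a b = f (toℕ a) ≡ᵇ toℕ b

module _ {k : ℕ} {f : ℕ → ℕ} (perm : IsPermutation< k f) where
  open IsPermutation< perm

  private
    ≡ᵇ-true : ∀ {x y} → x ≡ y → (x ≡ᵇ y) ≡ true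
    ≡ᵇ-true {x} {y} = Equivalence.to T-≡ ∘ ≡⇒≡ᵇ x y

    ≡ᵇ-true⁻¹ : ∀ {x y} → (x ≡ᵇ y) ≡ true → x ≡ y
    ≡ᵇ-true⁻¹ {x} {y} = ≡ᵇ⇒≡ x y ∘ Equivalence.from T-≡

  permutationMatrix-isPermutationMatrix : IsPermutationMatrix (permutationMatrix k f)
  permutationMatrix-isPermutationMatrix = row , column
    where
    row : ∀ a → ExactlyOneInRow (permutationMatrix k f) a
    row a = fromℕ< (bounded (toℕ a) (toℕ<n a)) , ≡ᵇ-true {f (toℕ a)} (sym (toℕ-fromℕ< _)) ,
            λ b e → toℕ-injective (trans (sym (≡ᵇ-true⁻¹ e)) (sym (toℕ-fromℕ< _)))
    column : ∀ b → ExactlyOneInCol (permutationMatrix k f) b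
    column b = let (i , i<k , fi≡b) = surjective (toℕ b) (toℕ<n b) in
      fromℕ< i<k , ≡ᵇ-true (trans (cong f (toℕ-fromℕ< i<k)) fi≡b) ,
      λ a e → toℕ-injective (trans (injective _ i (toℕ<n a) i<k (trans (≡ᵇ-true⁻¹ e) (sym fi≡b)))
                                   (sym (toℕ-fromℕ< i<k)))

  permutationMatrix-entry : ∀ i → i < k → EntryOne (permutationMatrix k f) i (f i)
  permutationMatrix-entry i i<k = fromℕ< i<k , fromℕ< (bounded i i<k) , toℕ-fromℕ< i<k , toℕ-fromℕ< _ ,
    ≡ᵇ-true (trans (cong f (toℕ-fromℕ< i<k)) (sym (toℕ-fromℕ< _)))

module PermutationOf {k : ℕ} (P : Matrix k k) (isP : IsPermutationMatrix P) where

  σ : Fin k → Fin k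
  σ a = proj₁ (proj₁ isP a)

  P[a,σa] : ∀ a → P a (σ a) ≡ true
  P[a,σa] a = proj₁ (proj₂ (proj₁ isP a))

  P-row : ∀ a b → P a b ≡ true → b ≡ σ a
  P-row a = proj₂ (proj₂ (proj₁ isP a))

  P-column : ∀ a a' b → P a b ≡ true → P a' b ≡ true → a ≡ a'
  P-column a a' b e e' = let (_ , _ , unique) = proj₂ isP b in trans (unique a e) (sym (unique a' e'))

  -- σ read on natural numbers; the value 0 outside {0, …, k - 1} is never used.
  q : ℕ → ℕ
  q i with i <? k
  ... | yes i<k = toℕ (σ (fromℕ< i<k))
  ... | no  _   = 0

  q-toℕ : ∀ a → q (toℕ a) ≡ toℕ (σ a)
  q-toℕ a with toℕ a <? k
  ... | yes a<k = cong (toℕ ∘ σ) (fromℕ<-toℕ a a<k)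
  ... | no  a≮k = ⊥-elim (a≮k (toℕ<n a))

  q-fromℕ< : ∀ i (i<k : i < k) → q i ≡ toℕ (σ (fromℕ< i<k))
  q-fromℕ< i i<k = trans (cong q (sym (toℕ-fromℕ< i<k))) (q-toℕ (fromℕ< i<k))

  q-permutation : IsPermutation< k q
  q-permutation = record
    { bounded    = λ i i<k → subst (_< k) (sym (q-fromℕ< i i<k)) (toℕ<n _)
    ; surjective = λ j j<k → let (a , Paj , _) = proj₂ isP (fromℕ< j<k) in
        toℕ a , toℕ<n a , trans (q-toℕ a) (trans (cong toℕ (sym (P-row a _ Paj))) (toℕ-fromℕ< j<k))
    ; injective  = λ i j i<k j<k e →
        let σi≡σj = toℕ-injective (trans (sym (q-fromℕ< i i<k)) (trans e (q-fromℕ< j j<k)))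
        in trans (sym (toℕ-fromℕ< i<k)) (trans (cong toℕ (P-column _ _ _
             (subst (λ c → P (fromℕ< i<k) c ≡ true) σi≡σj (P[a,σa] _)) (P[a,σa] _))) (toℕ-fromℕ< j<k))
    }

  EntryOne⇒q : ∀ {i j} → EntryOne P i j → q i ≡ j
  EntryOne⇒q (a , b , refl , refl , Pab) = trans (q-toℕ a) (cong toℕ (sym (P-row a b Pab)))

  q⇒EntryOne : ∀ {i j} → i < k → q i ≡ j → EntryOne P i j
  q⇒EntryOne {i} i<k qi≡j = fromℕ< i<k , σ (fromℕ< i<k) , toℕ-fromℕ< i<k ,
    trans (sym (q-fromℕ< i i<k)) qi≡j , P[a,σa] (fromℕ< i<k)

q-permutationMatrix : ∀ {k f} (perm : IsPermutation< k f) →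
  let open PermutationOf (permutationMatrix k f) (permutationMatrix-isPermutationMatrix perm) in
  ∀ i → i < k → q i ≡ f i
q-permutationMatrix perm i i<k = PermutationOf.EntryOne⇒q _ _ (permutationMatrix-entry perm i i<k)

ones-mono : ∀ {n} (A B : Matrix n n) → (∀ a b → A a b ≡ true → B a b ≡ true) → ones A ≤ ones B
ones-mono {n} A B A⊆B = sum-map-mono-≤ (allFin n) _ _ λ a →
  sum-map-mono-≤ (allFin n) _ _ λ b → cell (A a b) (B a b) (A⊆B a b)
  where
  cell : ∀ x y → (x ≡ true → y ≡ true) → ⟦ x ⟧ ≤ ⟦ y ⟧
  cell false _ _ = z≤n
  cell true  y x⇒y rewrite x⇒y refl = ≤-refl

∸-upper : ∀ {v Z M} c → v + Z ≡ M → c ≤ Z → v ≤ M ∸ c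
∸-upper {v} c refl c≤Z = m+n≤o⇒m≤o∸n v (+-monoʳ-≤ v c≤Z)

-- The shape (M + 8) ∸ (X + 4) is maxValue n k = (n² + 8) ∸ 4k with X = 4(k - 1); the
-- hypothesis X ≤ Z + 4 keeps the truncated subtraction honest.
shifted-upper : ∀ {v Z M} X → v + Z ≡ M → X ≤ Z + 4 → v ≤ (M + 8) ∸ (X + 4)
shifted-upper {v} {Z} X refl X≤Z+4 =
  m+n≤o⇒m≤o∸n v (subst (v + (X + 4) ≤_) (regroup v Z) (+-monoʳ-≤ v (+-monoˡ-≤ 4 X≤Z+4)))
  where
  regroup : ∀ v Z → v + (Z + 4 + 4) ≡ v + Z + 8
  regroup = solve-∀

shifted-exact : ∀ {v Z M} X → v + Z ≡ M → X ≤ Z + 4 → (v ≡ (M + 8) ∸ (X + 4) ⇔ Z + 4 ≡ X)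
shifted-exact {v} {Z} X refl X≤Z+4 = mk⇔
  (λ v≡ → sym (+-cancelʳ-≡ 4 X (Z + 4) (+-cancelˡ-≡ v _ _ (trans
    (trans (cong (_+ (X + 4)) v≡) (m∸n+n≡m X+4≤)) (sym (regroup v Z))))))
  (λ { refl → sym (trans (cong (_∸ (Z + 4 + 4)) (sym (regroup v Z))) (m+n∸n≡m v (Z + 4 + 4))) })
  where
  regroup : ∀ v Z → v + (Z + 4 + 4) ≡ v + Z + 8
  regroup = solve-∀
  X+4≤ : X + 4 ≤ v + Z + 8
  X+4≤ = ≤-trans (+-monoˡ-≤ 4 X≤Z+4) (≤-trans (≤-reflexive (+-assoc Z 4 4)) (+-monoˡ-≤ 8 (m≤n+m Z v)))

module MinimalForcing (K d : ℕ) (k≤d : suc K ≤ d) (P : Matrix (suc K) (suc K)) (isP : IsPermutationMatrix P) where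
  open PermutationOf P isP public
  open Geometry K d k≤d q q-permutation public

  minimal : Matrix n n
  minimal a b = covered (toℕ a) (toℕ b)

  ones-minimal : ones minimal ≡ ones-covered
  ones-minimal = sum-allFin≡∑ n _ (λ a → ∑ n (λ b → ⟦ covered a b ⟧))
    (λ a → sum-allFin≡∑ n _ (λ b → ⟦ covered (toℕ a) b ⟧) (λ b → refl))

  minimal-forcing : Forcing minimal P
  minimal-forcing r c r-inc c-inc i j Pij = covered-intro (toℕ (r i)) (toℕ (c j)) (toℕ i) (toℕ<n i)
    (increasing-≥ r r-inc i) (increasing-≤ d r r-inc i)
    (subst (_≤ toℕ (c j)) (sym qi≡j) (increasing-≥ c c-inc j))
    (subst (λ x → toℕ (c j) ≤ x + d) (sym qi≡j) (increasing-≤ d c c-inc j))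
    where
    qi≡j : q (toℕ i) ≡ toℕ j
    qi≡j = EntryOne⇒q (i , j , refl , refl , Pij)

  minimal-⊆ : ∀ A → Forcing A P → ∀ a b → minimal a b ≡ true → A a b ≡ true
  minimal-⊆ A A-forcing a b ab with covered-elim (toℕ a) (toℕ b) ab
  ... | i , i<k , p₁ , p₂ , p₃ , p₄
    with increasing-through d i (toℕ a) p₁ p₂ | increasing-through d (q i) (toℕ b) p₃ p₄
  ...   | r , r-inc , r-at-i | c , c-inc , c-at-qi =
    subst₂ (λ x y → A x y ≡ true)
      (toℕ-injective (r-at-i x (toℕ-fromℕ< i<k))) (toℕ-injective (c-at-qi (σ x) (sym (q-fromℕ< i i<k))))
      (A-forcing r c r-inc c-inc x (σ x) (P[a,σa] x))
    where
    x : Fin (suc K)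
    x = fromℕ< i<k

  isMinForcing⇔ : ∀ v → IsMinForcing n P v ⇔ v ≡ ones-covered
  isMinForcing⇔ v = mk⇔
    (λ { ((A , A-forcing , onesA≡v) , minimum) → ≤-antisym
           (subst (v ≤_) ones-minimal (minimum minimal minimal-forcing))
           (subst₂ _≤_ ones-minimal onesA≡v (ones-mono minimal A (minimal-⊆ A A-forcing))) })
    (λ { refl → (minimal , minimal-forcing , ones-minimal) ,
                λ A A-forcing → subst (_≤ ones A) ones-minimal (ones-mono minimal A (minimal-⊆ A A-forcing)) })

  value+zeros : ∀ {v} → IsMinForcing n P v → v + zeros ≡ n * n
  value+zeros {v} isMin = trans (cong (_+ zeros) (Equivalence.to (isMinForcing⇔ v) isMin)) ones-covered+zeros

  attains : ∀ {v} → v + zeros ≡ n * n → IsMinForcing n P v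
  attains {v} v+zeros≡n² = Equivalence.from (isMinForcing⇔ v) (+-cancelʳ-≡ zeros v ones-covered
    (trans v+zeros≡n² (sym ones-covered+zeros)))

  attains-∸ : ∀ {c} → zeros ≡ c → IsMinForcing n P (n * n ∸ c)
  attains-∸ {c} zeros≡c = attains (trans (cong ((n * n ∸ c) +_) zeros≡c) (m∸n+n≡m c≤n²))
    where
    c≤n² : c ≤ n * n
    c≤n² = subst₂ _≤_ zeros≡c ones-covered+zeros (m≤n+m zeros ones-covered)

  isMinForcing-shifted⇔ : ∀ X → X ≤ zeros + 4 → IsMinForcing n P ((n * n + 8) ∸ (X + 4)) ⇔ zeros + 4 ≡ X
  isMinForcing-shifted⇔ X X≤ = mk⇔
    (Equivalence.to shifted ∘ sym ∘ Equivalence.to (isMinForcing⇔ _))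
    (Equivalence.from (isMinForcing⇔ _) ∘ sym ∘ Equivalence.from shifted)
    where
    shifted : ones-covered ≡ (n * n + 8) ∸ (X + 4) ⇔ zeros + 4 ≡ X
    shifted = shifted-exact X ones-covered+zeros X≤

-- Extremal permutations

identity-permutation : ∀ k → IsPermutation< k id
identity-permutation k = inverses⇒permutation id id (λ _ → id) (λ _ → id) (λ _ _ → refl) (λ _ _ → refl)

swap₀₁ : ℕ → ℕ
swap₀₁ 0 = 1
swap₀₁ 1 = 0
swap₀₁ i = i

swap₀₁-permutation : IsPermutation< 3 swap₀₁
swap₀₁-permutation = inverses⇒permutation swap₀₁ swap₀₁ bounded bounded involutive involutive
  where
  bounded : ∀ i → i < 3 → swap₀₁ i < 3
  bounded 0 _ = s≤s (s≤s z≤n)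
  bounded 1 _ = s≤s z≤n
  bounded (suc (suc _)) i<3 = i<3
  involutive : ∀ i → i < 3 → swap₀₁ (swap₀₁ i) ≡ i
  involutive 0 _ = refl
  involutive 1 _ = refl
  involutive (suc (suc _)) _ = refl

-- The 4-cycle 0 ↦ 1 ↦ K ↦ K - 1 ↦ 0 on {0, …, K}, where K = 3 + m.
fourCycle fourCycle⁻¹ : ℕ → ℕ → ℕ
fourCycle m 0 = 1
fourCycle m 1 = 3 + m
fourCycle m (suc (suc t)) with t ≟ m | t ≟ suc m
... | yes _ | _     = 0
... | no _  | yes _ = 2 + m
... | no _  | no _  = 2 + t

fourCycle⁻¹ m 0 = 2 + m
fourCycle⁻¹ m 1 = 0
fourCycle⁻¹ m (suc (suc t)) with t ≟ m | t ≟ suc m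
... | yes _ | _     = 3 + m
... | no _  | yes _ = 1
... | no _  | no _  = 2 + t

module _ (m : ℕ) where
  private
    sm≢m : suc m ≢ m
    sm≢m = <⇒≢ (n<1+n m) ∘ sym

    region : ∀ t → t ≡ m ⊎ t ≡ suc m ⊎ (t ≢ m × t ≢ suc m)
    region t with t ≟ m | t ≟ suc m
    ... | yes t≡m | _        = inj₁ t≡m
    ... | no _    | yes t≡sm = inj₂ (inj₁ t≡sm)
    ... | no t≢m  | no t≢sm  = inj₂ (inj₂ (t≢m , t≢sm))

    fourCycle-K∸1 : fourCycle m (2 + m) ≡ 0
    fourCycle-K∸1 with m ≟ m
    ... | yes _  = refl
    ... | no m≢m = ⊥-elim (m≢m refl)

    fourCycle-K : fourCycle m (3 + m) ≡ 2 + m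
    fourCycle-K with suc m ≟ m | suc m ≟ suc m
    ... | yes sm≡m | _       = ⊥-elim (sm≢m sm≡m)
    ... | no _     | yes _   = refl
    ... | no _     | no ne   = ⊥-elim (ne refl)

    fourCycle-fixed : ∀ {t} → t ≢ m → t ≢ suc m → fourCycle m (2 + t) ≡ 2 + t
    fourCycle-fixed {t} t≢m t≢sm with t ≟ m | t ≟ suc m
    ... | yes t≡m | _        = ⊥-elim (t≢m t≡m)
    ... | no _    | yes t≡sm = ⊥-elim (t≢sm t≡sm)
    ... | no _    | no _     = refl

    fourCycle⁻¹-K∸1 : fourCycle⁻¹ m (2 + m) ≡ 3 + m
    fourCycle⁻¹-K∸1 with m ≟ m
    ... | yes _  = refl
    ... | no m≢m = ⊥-elim (m≢m refl)

    fourCycle⁻¹-K : fourCycle⁻¹ m (3 + m) ≡ 1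
    fourCycle⁻¹-K with suc m ≟ m | suc m ≟ suc m
    ... | yes sm≡m | _       = ⊥-elim (sm≢m sm≡m)
    ... | no _     | yes _   = refl
    ... | no _     | no ne   = ⊥-elim (ne refl)

    fourCycle⁻¹-fixed : ∀ {t} → t ≢ m → t ≢ suc m → fourCycle⁻¹ m (2 + t) ≡ 2 + t
    fourCycle⁻¹-fixed {t} t≢m t≢sm with t ≟ m | t ≟ suc m
    ... | yes t≡m | _        = ⊥-elim (t≢m t≡m)
    ... | no _    | yes t≡sm = ⊥-elim (t≢sm t≡sm)
    ... | no _    | no _     = refl

    bounded : ∀ i → i < 4 + m → fourCycle m i < 4 + m
    bounded 0 _ = s≤s (s≤s z≤n)
    bounded 1 _ = ≤-refl
    bounded (suc (suc t)) i<k with region t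
    ... | inj₁ refl        = subst (_< 4 + m) (sym fourCycle-K∸1) z<s
    ... | inj₂ (inj₁ refl) = subst (_< 4 + m) (sym fourCycle-K) (s≤s (s≤s (s≤s (n≤1+n m))))
    ... | inj₂ (inj₂ (t≢m , t≢sm)) = subst (_< 4 + m) (sym (fourCycle-fixed t≢m t≢sm)) i<k

    bounded⁻¹ : ∀ i → i < 4 + m → fourCycle⁻¹ m i < 4 + m
    bounded⁻¹ 0 _ = s≤s (s≤s (s≤s (n≤1+n m)))
    bounded⁻¹ 1 _ = s≤s z≤n
    bounded⁻¹ (suc (suc t)) i<k with region t
    ... | inj₁ refl        = subst (_< 4 + m) (sym fourCycle⁻¹-K∸1) ≤-refl
    ... | inj₂ (inj₁ refl) = subst (_< 4 + m) (sym fourCycle⁻¹-K) (s≤s (s≤s z≤n))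
    ... | inj₂ (inj₂ (t≢m , t≢sm)) = subst (_< 4 + m) (sym (fourCycle⁻¹-fixed t≢m t≢sm)) i<k

    left-inverse : ∀ i → i < 4 + m → fourCycle⁻¹ m (fourCycle m i) ≡ i
    left-inverse 0 _ = refl
    left-inverse 1 _ = fourCycle⁻¹-K
    left-inverse (suc (suc t)) _ with region t
    ... | inj₁ refl        = cong (fourCycle⁻¹ m) fourCycle-K∸1
    ... | inj₂ (inj₁ refl) = trans (cong (fourCycle⁻¹ m) fourCycle-K) fourCycle⁻¹-K∸1
    ... | inj₂ (inj₂ (t≢m , t≢sm)) = trans (cong (fourCycle⁻¹ m) (fourCycle-fixed t≢m t≢sm)) (fourCycle⁻¹-fixed t≢m t≢sm)

    right-inverse : ∀ i → i < 4 + m → fourCycle m (fourCycle⁻¹ m i) ≡ i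
    right-inverse 0 _ = fourCycle-K∸1
    right-inverse 1 _ = refl
    right-inverse (suc (suc t)) _ with region t
    ... | inj₁ refl        = trans (cong (fourCycle m) fourCycle⁻¹-K∸1) fourCycle-K
    ... | inj₂ (inj₁ refl) = cong (fourCycle m) fourCycle⁻¹-K
    ... | inj₂ (inj₂ (t≢m , t≢sm)) = trans (cong (fourCycle m) (fourCycle⁻¹-fixed t≢m t≢sm)) (fourCycle-fixed t≢m t≢sm)

  fourCycle-permutation : IsPermutation< (4 + m) (fourCycle m)
  fourCycle-permutation = inverses⇒permutation (fourCycle m) (fourCycle⁻¹ m) bounded bounded⁻¹ left-inverse right-inverse

  fourCycle-values : fourCycle m 0 ≡ 1 × fourCycle m 1 ≡ 3 + m × fourCycle m (3 + m) ≡ 2 + m × fourCycle m (2 + m) ≡ 0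
  fourCycle-values = refl , refl , fourCycle-K , fourCycle-K∸1

4*suc : ∀ K → 4 * suc K ≡ 4 * K + 4
4*suc K = trans (*-suc 4 K) (+-comm 4 (4 * K))

maxValue-upper : ∀ K d → suc K ≤ d → ∀ (P : Matrix (suc K) (suc K)) → IsPermutationMatrix P →
  ∀ v → IsMinForcing (suc K + d) P v → v ≤ maxValue (suc K + d) (suc K)
maxValue-upper 0 d k≤d P isP v isMin = ≤-trans (m≤m+n v zeros) (≤-reflexive (value+zeros isMin))
  where open MinimalForcing 0 d k≤d P isP
maxValue-upper 1 d k≤d P isP v isMin = ∸-upper 2 (value+zeros isMin) (zeros-lower-K≡1 refl (q0≢qK ≤-refl))
  where open MinimalForcing 1 d k≤d P isP
maxValue-upper 2 d k≤d P isP v isMin = ∸-upper 5 (value+zeros isMin) (zeros-lower-K≡2 refl (q0≢qK (s≤s z≤n)))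
  where open MinimalForcing 2 d k≤d P isP
maxValue-upper K@(suc (suc (suc _))) d k≤d P isP v isMin = subst (v ≤_) (cong (n * n + 8 ∸_) (sym (4*suc K)))
  (shifted-upper (4 * K) (value+zeros isMin) zeros-lower)
  where open MinimalForcing K d k≤d P isP

maxValue-attained : ∀ K d → suc K ≤ d →
  Σ (Matrix (suc K) (suc K)) λ P → IsPermutationMatrix P × IsMinForcing (suc K + d) P (maxValue (suc K + d) (suc K))
maxValue-attained 0 d k≤d = _ , isP , attains-∸ (n≤0⇒n≡0 (zeros-≤ q0 q0 (i₀-unique z<s q0) (iK-unique z<s q0)))
  where
  perm : IsPermutation< 1 id
  perm = identity-permutation 1
  isP : IsPermutationMatrix (permutationMatrix 1 id)
  isP = permutationMatrix-isPermutationMatrix perm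
  open MinimalForcing 0 d k≤d _ isP
  q0 : q 0 ≡ 0
  q0 = q-permutationMatrix perm 0 z<s
maxValue-attained 1 d k≤d = _ , isP ,
  attains-∸ (≤-antisym (zeros-≤ q0 q1 (i₀-unique z<s q0) (iK-unique ≤-refl q1)) (zeros-lower-K≡1 refl (q0≢qK ≤-refl)))
  where
  perm : IsPermutation< 2 id
  perm = identity-permutation 2
  isP : IsPermutationMatrix (permutationMatrix 2 id)
  isP = permutationMatrix-isPermutationMatrix perm
  open MinimalForcing 1 d k≤d _ isP
  q0 : q 0 ≡ 0
  q0 = q-permutationMatrix perm 0 z<s
  q1 : q 1 ≡ 1
  q1 = q-permutationMatrix perm 1 ≤-refl
maxValue-attained 2 d k≤d = _ , isP ,
  attains-∸ (≤-antisym (zeros-≤ q0 q2 (i₀-unique (s≤s z<s) q1) (iK-unique ≤-refl q2))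
                       (zeros-lower-K≡2 refl (q0≢qK (s≤s z≤n))))
  where
  isP : IsPermutationMatrix (permutationMatrix 3 swap₀₁)
  isP = permutationMatrix-isPermutationMatrix swap₀₁-permutation
  open MinimalForcing 2 d k≤d _ isP
  q0 : q 0 ≡ 1
  q0 = q-permutationMatrix swap₀₁-permutation 0 z<s
  q1 : q 1 ≡ 0
  q1 = q-permutationMatrix swap₀₁-permutation 1 (s≤s z<s)
  q2 : q 2 ≡ 2
  q2 = q-permutationMatrix swap₀₁-permutation 2 ≤-refl
maxValue-attained K@(suc (suc (suc m))) d k≤d = _ , isP ,
  subst (IsMinForcing n _) (cong (n * n + 8 ∸_) (sym (4*suc K)))
    (Equivalence.from (isMinForcing-shifted⇔ (4 * K) zeros-lower)
      (≤-antisym (pattern⇒zeros-tight 3≤K (inj₁ pattern₁)) zeros-lower))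
  where
  perm : IsPermutation< (4 + m) (fourCycle m)
  perm = fourCycle-permutation m
  isP : IsPermutationMatrix (permutationMatrix (4 + m) (fourCycle m))
  isP = permutationMatrix-isPermutationMatrix perm
  open MinimalForcing K d k≤d _ isP
  3≤K : 3 ≤ K
  3≤K = s≤s (s≤s (s≤s z≤n))
  pattern₁ : Pattern₁
  pattern₁ = let (v0 , v1 , vK , vK∸1) = fourCycle-values m in
    trans (q-permutationMatrix perm 0 z<s) v0 , trans (q-permutationMatrix perm 1 (s≤s (s≤s z≤n))) v1 ,
    trans (q-permutationMatrix perm K ≤-refl) vK , trans (q-permutationMatrix perm (K ∸ 1) (s≤s (n≤1+n _))) vK∸1

maxValue-characterisation : ∀ K d → suc K ≤ d → 4 ≤ suc K → ∀ (P : Matrix (suc K) (suc K)) → IsPermutationMatrix P →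
  (IsMinForcing (suc K + d) P (maxValue (suc K + d) (suc K))
    ⇔ ((EntryOne P 0 1 × EntryOne P 1 K × EntryOne P K (K ∸ 1) × EntryOne P (K ∸ 1) 0)
       ⊎ (EntryOne P 1 0 × EntryOne P K 1 × EntryOne P (K ∸ 1) K × EntryOne P 0 (K ∸ 1))))
maxValue-characterisation 0 _ _ (s≤s ())
maxValue-characterisation 1 _ _ (s≤s (s≤s ()))
maxValue-characterisation 2 _ _ (s≤s (s≤s (s≤s ())))
maxValue-characterisation K@(suc (suc (suc m))) d k≤d _ P isP = mk⇔
  (toEntries ∘ zeros-tight⇒pattern 3≤K ∘ Equivalence.to value⇔tight)
  (Equivalence.from value⇔tight ∘ (λ p → ≤-antisym (pattern⇒zeros-tight 3≤K p) zeros-lower) ∘ fromEntries)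
  where
  open MinimalForcing K d k≤d P isP
  3≤K : 3 ≤ K
  3≤K = s≤s (s≤s (s≤s z≤n))
  value⇔tight : IsMinForcing n P (maxValue n (suc K)) ⇔ zeros + 4 ≡ 4 * K
  value⇔tight = subst (λ V → IsMinForcing n P V ⇔ zeros + 4 ≡ 4 * K) (cong (n * n + 8 ∸_) (sym (4*suc K)))
    (isMinForcing-shifted⇔ (4 * K) zeros-lower)
  1<k : 1 < suc K
  1<k = s≤s (s≤s z≤n)
  K∸1<k : K ∸ 1 < suc K
  K∸1<k = s≤s (n≤1+n _)
  Entries : Set
  Entries = (EntryOne P 0 1 × EntryOne P 1 K × EntryOne P K (K ∸ 1) × EntryOne P (K ∸ 1) 0)
          ⊎ (EntryOne P 1 0 × EntryOne P K 1 × EntryOne P (K ∸ 1) K × EntryOne P 0 (K ∸ 1))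
  toEntries : Pattern₁ ⊎ Pattern₂ → Entries
  toEntries (inj₁ (a , b , c , e)) = inj₁ (q⇒EntryOne z<s a , q⇒EntryOne 1<k b , q⇒EntryOne ≤-refl c , q⇒EntryOne K∸1<k e)
  toEntries (inj₂ (a , b , c , e)) = inj₂ (q⇒EntryOne 1<k a , q⇒EntryOne ≤-refl b , q⇒EntryOne K∸1<k c , q⇒EntryOne z<s e)
  fromEntries : Entries → Pattern₁ ⊎ Pattern₂
  fromEntries (inj₁ (a , b , c , e)) = inj₁ (EntryOne⇒q a , EntryOne⇒q b , EntryOne⇒q c , EntryOne⇒q e)
  fromEntries (inj₂ (a , b , c , e)) = inj₂ (EntryOne⇒q a , EntryOne⇒q b , EntryOne⇒q c , EntryOne⇒q e)

split-2k≤n : ∀ n k → 2 * k ≤ n → Σ ℕ λ d → k ≤ d × k + d ≡ n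
split-2k≤n n k 2k≤n = n ∸ k , m+n≤o⇒m≤o∸n k k+k≤n , m+[n∸m]≡n (≤-trans (m≤m+n k k) k+k≤n)
  where
  k+k≤n : k + k ≤ n
  k+k≤n = subst (_≤ n) (cong (k +_) (+-identityʳ k)) 2k≤n

lemma3 : ∀ (n k : ℕ) → 1 ≤ k → 2 * k ≤ n →
    ((∀ (P : Matrix k k) → IsPermutationMatrix P →
        ∀ v → IsMinForcing n P v → v ≤ maxValue n k)
     × (Σ (Matrix k k) λ P → IsPermutationMatrix P × IsMinForcing n P (maxValue n k)))
    × (4 ≤ k → ∀ (P : Matrix k k) → IsPermutationMatrix P →
        (IsMinForcing n P (maxValue n k)
          ⇔ ((EntryOne P 0 1 × EntryOne P 1 (k ∸ 1) × EntryOne P (k ∸ 1) (k ∸ 2) × EntryOne P (k ∸ 2) 0)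
             ⊎ (EntryOne P 1 0 × EntryOne P (k ∸ 1) 1 × EntryOne P (k ∸ 2) (k ∸ 1) × EntryOne P 0 (k ∸ 2)))))
lemma3 n (suc K) _ 2k≤n with split-2k≤n n (suc K) 2k≤n
... | d , k≤d , refl = (maxValue-upper K d k≤d , maxValue-attained K d k≤d) , maxValue-characterisation K d k≤d
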